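{- Let $\Gamma$ be a finite nonabelian group. For a matroid $M$ the following are equivalent: (1) $M$ is representable over $\Gamma$; (2) $M$ does not have $U_{2,3}$ as a minor; (3) the simplification of $M$ is $U_{n,n}$ for some $n$, or $M$ consists entirely of loops; (4) $M$ is representable over every finite group.
   Context: A polymatroid is a pair $(E,r)$, $E$ finite, $r:2^E\to\mathbb{R}_{\ge0}$ with $r(\emptyset)=0$, $r$ monotone, and $r(S)+r(T)\ge r(S\cup T)+r(S\cap T)$. A matroid is a polymatroid with integer-valued rank function satisfying $r(S)\le|S|$ for all $S$. Two polymatroids $(E,r),(E',r')$ are isomorphic if there is a bijection $E\to E'$ preserving rank. For a finite group $\Gamma$, a finite set $E'$ and a subgroup $\mathcal{H}\le\Gamma^{E'}$, let $P(\mathcal{H})=(E',r_{\mathcal{H}})$ where $r_{\mathcal{H}}(S)=\log_{|\Gamma|}|\pi_S(\mathcal{H})|$, with $\pi_S:\Gamma^{E'}\to\Gamma^S$ the coordinate projection ($\pi_\emptyset(\mathcal H)$ trivial). A polymatroid is representable over $\Gamma$ if it is isomorphic to $P(\mathcal{H})$ for some finite $E'$ and some subgroup $\mathcal{H}\le\Gamma^{E'}$. For $S\subseteq E$, the deletion $P\setminus S$ has ground set $E-S$ and rank $r$ restricted; the contraction $P/S$ has ground set $E-S$ and rank $T\mapsto r(S\cup T)-r(S)$; a minor is obtained by a sequence of deletions and contractions. $U_{d,n}$ is the matroid on $[n]$ with $r(S)=\min(d,|S|)$. A loop is an element $x$ with $r(\{x\})=0$; distinct $x,y$ are parallel if $0<r(\{x\})=r(\{y\})=r(\{x,y\})$;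 the simplification of a matroid is obtained by deleting all loops and all but one element of each parallel class. -}

module Defs where

open import Data.Nat using (ℕ; zero; suc; _+_; _∸_; _^_; _≤_; _<_; _⊓_)
open import Data.Fin using (Fin; zero; suc; _≟_)
open import Data.Fin.Subset using (Subset; ⊥; ⁅_⁆; _∪_; _∩_; _⊆_; ∣_∣)
open import Data.Bool using (Bool; true; false; if_then_else_)
open import Data.Maybe using (Maybe; just; nothing)
open import Data.Vec using (Vec; []; _∷_; zipWith; replicate; insertAt)
import Data.Vec as V
import Data.Vec.Properties as VP
import Data.Maybe.Properties as MP
open import Data.List using (List; length; deduplicate)
import Data.List as L
open import Data.List.Membership.Propositional using (_∈_)
open import Data.Product using (Σ; ∃; ∃-syntax; _×_; _,_)
open import Data.Sum using (_⊎_)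
open import Relation.Binary.PropositionalEquality using (_≡_; _≢_)
open import Relation.Nullary using (¬_)
open import Algebra.Core using (Op₁; Op₂)
open import Algebra.Structures using (IsGroup)
open import Function using (_∘_)
open import Function.Bundles using (_↔_; Inverse)
open import Function.Definitions using (Injective)

-- Finite groups: a group structure on Fin m (every finite group is
-- isomorphic to one of these), with propositional equality.

record FinGroup (m : ℕ) : Set where
  field
    _∙_     : Op₂ (Fin m)
    ε       : Fin m
    _⁻¹     : Op₁ (Fin m)
    isGroup : IsGroup _≡_ _∙_ ε _⁻¹

NonAbelian : ∀ {m} → FinGroup m → Set
NonAbelian Γ = ∃[ x ] ∃[ y ] (x ∙ y ≢ y ∙ x)
  where open FinGroup Γ

-- Subgroups H ≤ Γ^{E'} with E' = Fin k, given as a finite list of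
-- elements (vectors), containing the identity and closed under the
-- (coordinatewise) group operations.

record Subgroup {m : ℕ} (Γ : FinGroup m) (k : ℕ) : Set where
  open FinGroup Γ
  field
    elems    : List (Vec (Fin m) k)
    has-ε    : replicate k ε ∈ elems
    closed-∙ : ∀ {u v} → u ∈ elems → v ∈ elems → zipWith _∙_ u v ∈ elems
    closed-⁻¹ : ∀ {u} → u ∈ elems → V.map _⁻¹ u ∈ elems

-- Coordinate projection π_S : Γ^{k} → Γ^S, encoded by forgetting the
-- coordinates outside S (an injective encoding of Γ^S).
proj : ∀ {m k} → Subset k → Vec (Fin m) k → Vec (Maybe (Fin m)) k
proj S v = zipWith (λ b x → if b then just x else nothing) S v

projCard : ∀ {m k} {Γ : FinGroup m} → Subgroup Γ k → Subset k → ℕ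
projCard H S =
  length (deduplicate (VP.≡-dec (MP.≡-dec _≟_)) (L.map (proj S) (Subgroup.elems H)))

Rank : ℕ → Set
Rank n = Subset n → ℕ

record IsMatroid {n : ℕ} (r : Rank n) : Set where
  field
    r-∅       : r ⊥ ≡ 0
    r-mono    : ∀ {S T} → S ⊆ T → r S ≤ r T
    r-submod  : ∀ S T → r (S ∪ T) + r (S ∩ T) ≤ r S + r T
    r-≤-card  : ∀ S → r S ≤ ∣ S ∣

image : ∀ {k n} → (Fin k → Fin n) → Subset k → Subset n
image {zero}  f []      = ⊥
image {suc k} f (b ∷ S) = (if b then ⁅ f zero ⁆ else ⊥) ∪ image (f ∘ suc) S

Isomorphic : ∀ {n k} → Rank n → Rank k → Set
Isomorphic {n} {k} r u =
  Σ (Fin n ↔ Fin k) λ σ → ∀ S → u (image (Inverse.to σ) S) ≡ r S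

-- Representability over Γ (for an integer-valued rank function):
-- r ≅ P(H), i.e. log_{|Γ|} |π_{σ(S)}(H)| = r S, i.e. |π_{σ(S)}(H)| = |Γ|^{r S}.
Representable : ∀ {m} → FinGroup m → ∀ {n} → Rank n → Set
Representable {m} Γ {n} r =
  ∃[ k ] Σ (Subgroup Γ k) λ H → Σ (Fin n ↔ Fin k) λ σ →
    ∀ S → projCard H (image (Inverse.to σ) S) ≡ m ^ r S

delete : ∀ {n} → Fin (suc n) → Rank (suc n) → Rank n
delete i r S = r (insertAt S i false)

contract : ∀ {n} → Fin (suc n) → Rank (suc n) → Rank n
contract i r S = r (insertAt S i true) ∸ r ⁅ i ⁆

data HasMinor : ∀ {n} → Rank n → ∀ {k} → Rank k → Set where
  iso : ∀ {n k} {r : Rank n} {u : Rank k} → Isomorphic r u → HasMinor r u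
  del : ∀ {n k} {r : Rank (suc n)} {u : Rank k} (i : Fin (suc n)) →
        HasMinor (delete i r) u → HasMinor r u
  con : ∀ {n k} {r : Rank (suc n)} {u : Rank k} (i : Fin (suc n)) →
        HasMinor (contract i r) u → HasMinor r u

U : (d n : ℕ) → Rank n
U d n S = ∣ S ∣ ⊓ d

IsLoop : ∀ {n} → Rank n → Fin n → Set
IsLoop r x = r ⁅ x ⁆ ≡ 0

Parallel : ∀ {n} → Rank n → Fin n → Fin n → Set
Parallel r x y =
  x ≢ y × 0 < r ⁅ x ⁆ × r ⁅ x ⁆ ≡ r ⁅ y ⁆ × r ⁅ y ⁆ ≡ r (⁅ x ⁆ ∪ ⁅ y ⁆)

IsSimplificationMap : ∀ {n k} → Rank n → (Fin k → Fin n) → Set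
IsSimplificationMap r f =
  Injective _≡_ _≡_ f
  × (∀ j → ¬ IsLoop r (f j))
  × (∀ j j′ → ¬ Parallel r (f j) (f j′))
  × (∀ x → ¬ IsLoop r x → ∃[ j ] (f j ≡ x ⊎ Parallel r x (f j)))

restrictAlong : ∀ {n k} → Rank n → (Fin k → Fin n) → Rank k
restrictAlong r f S = r (image f S)

SimplificationIsFree : ∀ {n} → Rank n → Set
SimplificationIsFree {n} r =
  ∃[ k ] Σ (Fin k → Fin n) λ f →
    IsSimplificationMap r f × ∃[ d ] Isomorphic (restrictAlong r f) (U d d)

AllLoops : ∀ {n} → Rank n → Set
AllLoops r = ∀ x → IsLoop r x

-- (1)⇒(2): a representation H ≤ Γ^E passes to deletions, and to the contraction by c via the kernel H_c
-- of the c-th coordinate, since |π_{c ∪ T}(H)| = |π_c(H)| · |π_T(H_c)|.  A representation of U₂,₃ on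
-- points p, q, s makes Γ abelian: elements of H_q and of H_p take arbitrary values γ, δ at s, while
-- their commutator lies in H_{p,q}, whose s-coordinate is trivial.
-- (2)⇒(3): in a U₂,₃-free matroid, an element that does not raise the rank of S is a loop or is parallel
-- to an element of S.  By induction: delete or contract some z ∈ S; a pair parallel in the contraction
-- is parallel in M or forms a triangle, i.e. a U₂,₃ restriction, with z.  So the kept elements of the
-- simplification are independent.
-- (3)⇒(4): with d the rank, the image of Γ^d under a ↦ (a_{class of x})_x, and ε on the loops,
-- represents the matroid over any group.

module Submission where

open import Level using (0ℓ)
open import Data.Nat using (ℕ; zero; suc; _+_; _*_; _∸_; _^_; _≤_; _<_; z≤n; s≤s; _⊓_)
import Data.Nat as ℕ
open import Data.Nat.Properties
  using ( ≤-trans; ≤-antisym; <-irrefl; ≤-<-connex; <-≤-trans; m≤m+n; +-comm; +-identityʳ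
        ; +-mono-≤; +-monoʳ-≤; +-cancelʳ-≤; *-identityʳ; *-monoʳ-≤; *-cancelˡ-≡; ^-monoʳ-<; ^-distribˡ-+-*
        ; m^n≢0; m+[n∸m]≡n; +-∸-assoc; +-∸-comm; ∸-+-assoc; m≤n+o⇒m∸n≤o; ∸-monoˡ-≤; n∸n≡0
        ; m∸n≡0⇒m≤n; m∸n≢0⇒n<m; ∸-cancelʳ-≡; 0≢1+n; m≤n⇒m<n∨m≡n; m≤n⇒m⊓n≡m )
open import Data.Bool using (Bool; true; false; _∨_; _∧_; if_then_else_)
open import Data.Maybe using (Maybe; just; nothing; fromMaybe)
open import Data.Maybe.Properties using (just-injective)
import Data.Maybe.Properties as MaybeP
open import Data.Fin using (Fin; zero; suc; _≟_; punchIn; punchOut)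
import Data.Fin as Fin
open import Data.Fin.Properties
  using ( injective⇒≤; suc-injective; punchIn-punchOut; punchIn-injective; punchInᵢ≢i; punchOut-injective
        ; all?; any?; ¬∀⟶∃¬ )
import Data.Fin.Properties as FinP
import Data.Fin.Induction as FinInd
open import Data.Fin.Subset using (Subset; ⊥; ⁅_⁆; _∪_; _∩_; _⊆_; _∈_; _∉_; ∣_∣)
open import Data.Fin.Subset.Properties
  using ( _∈?_; ⊆-antisym; x∈⁅x⁆; x∈⁅y⁆⇒x≡y; ∉⊥; x∈p∪q⁻; p⊆p∪q; q⊆p∪q; x∈p∩q⁺; drop-∷-⊆
        ; ∣⁅x⁆∣≡1; ∣p∣≤n; ∪-comm; ∪-assoc; ∪-idem; ∪-identityˡ; ∪-identityʳ; nonempty?; Empty-unique )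
open import Data.Vec using (Vec; []; _∷_; lookup; zipWith; replicate; insertAt; removeAt; tabulate)
import Data.Vec as Vec
open import Data.Vec.Base using (here; there)
open import Data.Vec.Properties using (insertAt-removeAt; []=⇒lookup)
import Data.Vec.Properties as VecP
open import Data.List
  using (List; []; _∷_; length; map; filter; deduplicate; allFin; cartesianProduct; cartesianProductWith)
import Data.List as List
open import Data.List.Properties using (length-++; length-map; length-tabulate; map-∘)
open import Data.List.Membership.Propositional using () renaming (_∈_ to _∈ₗ_)
open import Data.List.Membership.Propositional.Properties
  using ( ∈-map⁺; ∈-map⁻; ∈-filter⁺; ∈-filter⁻; ∈-deduplicate⁺; ∈-deduplicate⁻; ∈-lookup; ∈-allFin
        ; ∈-cartesianProduct⁺; ∈-cartesianProduct⁻; ∈-cartesianProductWith⁺ )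
open import Data.List.Relation.Unary.Any as Any using (here; there)
open import Data.List.Relation.Unary.Any.Properties using (lookup-index)
open import Data.List.Relation.Unary.All using ([]; _∷_)
import Data.List.Relation.Unary.All as ListAll
open import Data.List.Relation.Unary.All.Properties using (¬Any⇒All¬)
open import Data.List.Relation.Unary.AllPairs using ([]; _∷_)
open import Data.List.Relation.Unary.Unique.Propositional using (Unique)
import Data.List.Relation.Unary.Unique.Propositional.Properties as UniqueP
open import Data.List.Relation.Unary.Unique.DecPropositional.Properties using (deduplicate-!)
open import Data.Product using (∃-syntax; _×_; _,_; proj₁; proj₂)
import Data.Product.Properties as ProductP
open import Data.Sum using (_⊎_; inj₁; inj₂; [_,_])
open import Data.Empty using (⊥-elim)
open import Function using (_∘_; id)
open import Function.Bundles using (_⇔_; mk⇔; _↔_; Inverse; mk↔ₛ′)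
open import Function.Construct.Identity using (↔-id)
open import Function.Definitions using (Injective)
import Induction.WellFounded as WF
open import Relation.Nullary using (¬_; Dec; yes; no; does)
open import Relation.Nullary.Decidable using (_×-dec_; _⊎-dec_; ¬?)
open import Relation.Unary using (Decidable)
open import Relation.Binary.Definitions using (DecidableEquality; tri<; tri≈; tri>)
open import Relation.Binary.PropositionalEquality
  using (_≡_; _≢_; refl; sym; trans; cong; cong₂; subst; subst₂; module ≡-Reasoning)
open import Algebra.Bundles using (Group)
open import Algebra.Structures using (IsGroup)
import Algebra.Properties.Group as GroupProperties
open import Defs

-- Counting distinct entries of lists

InjectiveOn : ∀ {A B : Set} → (A → B) → List A → Set
InjectiveOn f xs = ∀ {x y} → x ∈ₗ xs → y ∈ₗ xs → f x ≡ f y → x ≡ y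

MapsInto : ∀ {A B : Set} → (A → B) → List A → List B → Set
MapsInto f xs ys = ∀ {x} → x ∈ₗ xs → f x ∈ₗ ys

lookup-injective : ∀ {A : Set} {xs : List A} → Unique xs →
                   ∀ i j → List.lookup xs i ≡ List.lookup xs j → i ≡ j
lookup-injective (_ ∷ _)  zero    zero    _  = refl
lookup-injective (x∉ ∷ _) zero    (suc j) eq = ⊥-elim (ListAll.lookup x∉ (∈-lookup j) eq)
lookup-injective (x∉ ∷ _) (suc i) zero    eq = ⊥-elim (ListAll.lookup x∉ (∈-lookup i) (sym eq))
lookup-injective (_ ∷ u)  (suc i) (suc j) eq = cong suc (lookup-injective u i j eq)

length-≤-injection : ∀ {A B : Set} {xs : List A} {ys : List B} (f : A → B) →
                     Unique xs → MapsInto f xs ys → InjectiveOn f xs →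
                     length xs ≤ length ys
length-≤-injection {xs = xs} {ys} f unique into inj = injective⇒≤ index-injective
  where
  index : Fin (length xs) → Fin (length ys)
  index i = Any.index (into (∈-lookup i))
  index-injective : ∀ {i j} → index i ≡ index j → i ≡ j
  index-injective {i} {j} eq = lookup-injective unique i j (inj (∈-lookup i) (∈-lookup j)
    (trans (lookup-index (into (∈-lookup i)))
      (trans (cong (List.lookup ys) eq) (sym (lookup-index (into (∈-lookup j)))))))

module _ {A : Set} (_≟_ : DecidableEquality A) where

  card : List A → ℕ
  card xs = length (deduplicate _≟_ xs)

  card-unique : ∀ {xs} → Unique xs → card xs ≡ length xs
  card-unique {xs} u = ≤-antisym
    (length-≤-injection id (deduplicate-! _≟_ xs) (∈-deduplicate⁻ _≟_ xs) (λ _ _ eq → eq))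
    (length-≤-injection id u (∈-deduplicate⁺ _≟_) (λ _ _ eq → eq))

  card-pos : ∀ {x xs} → x ∈ₗ xs → 1 ≤ card xs
  card-pos {xs = _ ∷ _} _ = s≤s z≤n

card-≤-injection : ∀ {A B : Set} (_≟A_ : DecidableEquality A) (_≟B_ : DecidableEquality B)
                   {xs : List A} {ys : List B} (f : A → B) →
                   MapsInto f xs ys → InjectiveOn f xs → card _≟A_ xs ≤ card _≟B_ ys
card-≤-injection _≟A_ _≟B_ {xs} f into inj = length-≤-injection f (deduplicate-! _≟A_ xs)
  (λ x∈ → ∈-deduplicate⁺ _≟B_ (into (∈-deduplicate⁻ _≟A_ xs x∈)))
  (λ x∈ y∈ → inj (∈-deduplicate⁻ _≟A_ xs x∈) (∈-deduplicate⁻ _≟A_ xs y∈))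

card-≡-inverse : ∀ {A B : Set} (_≟A_ : DecidableEquality A) (_≟B_ : DecidableEquality B)
                 {xs : List A} {ys : List B} (f : A → B) (g : B → A) →
                 MapsInto f xs ys → MapsInto g ys xs →
                 (∀ {x} → x ∈ₗ xs → g (f x) ≡ x) → (∀ {y} → y ∈ₗ ys → f (g y) ≡ y) →
                 card _≟A_ xs ≡ card _≟B_ ys
card-≡-inverse _≟A_ _≟B_ f g f-into g-into gf fg = ≤-antisym
  (card-≤-injection _≟A_ _≟B_ f f-into (λ x∈ y∈ eq → trans (sym (gf x∈)) (trans (cong g eq) (gf y∈))))
  (card-≤-injection _≟B_ _≟A_ g g-into (λ x∈ y∈ eq → trans (sym (fg x∈)) (trans (cong f eq) (fg y∈))))

card-≡1⇒≡ : ∀ {A : Set} (_≟_ : DecidableEquality A) {xs : List A} → card _≟_ xs ≡ 1 →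
            ∀ {x y} → x ∈ₗ xs → y ∈ₗ xs → x ≡ y
card-≡1⇒≡ _≟_ {xs} eq x∈ y∈ =
  single (deduplicate _≟_ xs) eq (∈-deduplicate⁺ _≟_ x∈) (∈-deduplicate⁺ _≟_ y∈)
  where
  single : ∀ {A : Set} (zs : List A) → length zs ≡ 1 → ∀ {x y} → x ∈ₗ zs → y ∈ₗ zs → x ≡ y
  single (_ ∷ []) _ (here refl) (here refl) = refl

card-≡size⇒∈ : ∀ {m} {xs : List (Fin m)} → card _≟_ xs ≡ m → ∀ α → α ∈ₗ xs
card-≡size⇒∈ {m} {xs} eq α with Any.any? (_≟_ α) xs
... | yes α∈ = α∈
... | no  α∉ = ⊥-elim (<-irrefl eq (subst (suc (card _≟_ xs) ≤_) (length-tabulate id)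
                 (length-≤-injection id (¬Any⇒All¬ _ (α∉ ∘ ∈-deduplicate⁻ _≟_ xs) ∷ deduplicate-! _≟_ xs)
                   (λ _ → ∈-allFin _) (λ _ _ eq → eq))))

module _ {A B : Set} (_≟_ : DecidableEquality B) (f : A → B) (default : A) where

  preimage : List A → B → A
  preimage []       y = default
  preimage (x ∷ xs) y with f x ≟ y
  ... | yes _ = x
  ... | no  _ = preimage xs y

  preimage-spec : ∀ {xs y} → y ∈ₗ map f xs → preimage xs y ∈ₗ xs × f (preimage xs y) ≡ y
  preimage-spec {x ∷ xs} {y} y∈ with f x ≟ y
  ... | yes fx≡y = here refl , fx≡y
  preimage-spec {x ∷ xs} (here refl) | no fx≢y = ⊥-elim (fx≢y refl)
  preimage-spec {x ∷ xs} (there y∈)  | no _    = let (p∈ , fp≡y) = preimage-spec y∈ in there p∈ , fp≡y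

card-map-sameKernel : ∀ {A B C : Set} (_≟B_ : DecidableEquality B) (_≟C_ : DecidableEquality C)
                      (p : A → B) (q : A → C) (default : A) (xs : List A) →
                      (∀ {a a′} → a ∈ₗ xs → a′ ∈ₗ xs → p a ≡ p a′ → q a ≡ q a′) →
                      (∀ {a a′} → a ∈ₗ xs → a′ ∈ₗ xs → q a ≡ q a′ → p a ≡ p a′) →
                      card _≟B_ (map p xs) ≡ card _≟C_ (map q xs)
card-map-sameKernel {A} {B} {C} _≟B_ _≟C_ p q default xs p⇒q q⇒p =
  card-≡-inverse _≟B_ _≟C_ (q ∘ liftP) (p ∘ liftQ)
    (λ v∈ → ∈-map⁺ q (proj₁ (liftP-spec v∈))) (λ w∈ → ∈-map⁺ p (proj₁ (liftQ-spec w∈)))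
    (λ v∈ → let (a∈ , pa≡v) = liftP-spec v∈ ; (a′∈ , qa′≡qa) = liftQ-spec (∈-map⁺ q a∈) in
            trans (q⇒p a′∈ a∈ qa′≡qa) pa≡v)
    (λ w∈ → let (a∈ , qa≡w) = liftQ-spec w∈ ; (a′∈ , pa′≡pa) = liftP-spec (∈-map⁺ p a∈) in
            trans (p⇒q a′∈ a∈ pa′≡pa) qa≡w)
  where
  liftP : B → A
  liftP = preimage _≟B_ p default xs
  liftQ : C → A
  liftQ = preimage _≟C_ q default xs
  liftP-spec : ∀ {v} → v ∈ₗ map p xs → liftP v ∈ₗ xs × p (liftP v) ≡ v
  liftP-spec = preimage-spec _≟B_ p default
  liftQ-spec : ∀ {w} → w ∈ₗ map q xs → liftQ w ∈ₗ xs × q (liftQ w) ≡ w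
  liftQ-spec = preimage-spec _≟C_ q default

length-cartesianProductWith : ∀ {A B C : Set} (f : A → B → C) (xs : List A) (ys : List B) →
                              length (cartesianProductWith f xs ys) ≡ length xs * length ys
length-cartesianProductWith f []       ys = refl
length-cartesianProductWith f (x ∷ xs) ys = trans (length-++ (map (f x) ys))
  (cong₂ _+_ (length-map (f x) ys) (length-cartesianProductWith f xs ys))

-- Subsets: insertion of a coordinate, images

insertAt-zipWith : ∀ {A : Set} {n} (f : A → A → A) (xs ys : Vec A n) (i : Fin (suc n)) x y →
                   insertAt (zipWith f xs ys) i (f x y) ≡ zipWith f (insertAt xs i x) (insertAt ys i y)
insertAt-zipWith f xs       ys       zero    x y = refl
insertAt-zipWith f (a ∷ xs) (b ∷ ys) (suc i) x y = cong (f a b ∷_) (insertAt-zipWith f xs ys i x y)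

module _ {n : ℕ} where

  insertAt-∪ : ∀ (S T : Subset n) i a b → insertAt (S ∪ T) i (a ∨ b) ≡ insertAt S i a ∪ insertAt T i b
  insertAt-∪ = insertAt-zipWith _∨_

  insertAt-∩ : ∀ (S T : Subset n) i a b → insertAt (S ∩ T) i (a ∧ b) ≡ insertAt S i a ∩ insertAt T i b
  insertAt-∩ = insertAt-zipWith _∧_

insertAt-⊥ : ∀ {n} (i : Fin (suc n)) → insertAt ⊥ i false ≡ ⊥
insertAt-⊥ zero            = refl
insertAt-⊥ {suc n} (suc i) = cong (false ∷_) (insertAt-⊥ i)

insertAt-⊥-true : ∀ {n} (i : Fin (suc n)) → insertAt ⊥ i true ≡ ⁅ i ⁆
insertAt-⊥-true zero            = refl
insertAt-⊥-true {suc n} (suc i) = cong (false ∷_) (insertAt-⊥-true i)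

insertAt-⁅⁆ : ∀ {n} (i : Fin (suc n)) (j : Fin n) → insertAt ⁅ j ⁆ i false ≡ ⁅ punchIn i j ⁆
insertAt-⁅⁆ zero    j       = refl
insertAt-⁅⁆ (suc i) zero    = cong (true ∷_) (insertAt-⊥ i)
insertAt-⁅⁆ (suc i) (suc j) = cong (false ∷_) (insertAt-⁅⁆ i j)

insertAt-true : ∀ {n} (S : Subset n) i → insertAt S i true ≡ ⁅ i ⁆ ∪ insertAt S i false
insertAt-true S       zero    = cong (true ∷_) (sym (∪-identityˡ S))
insertAt-true (b ∷ S) (suc i) = cong (b ∷_) (insertAt-true S i)

insertAt-removeAt-∈ : ∀ {n} {S : Subset (suc n)} {z} → z ∈ S → insertAt (removeAt S z) z true ≡ S
insertAt-removeAt-∈ {S = S} {z} z∈S =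
  trans (cong (insertAt (removeAt S z) z) (sym ([]=⇒lookup z∈S))) (insertAt-removeAt S z)

∣insertAt-false∣ : ∀ {n} (S : Subset n) i → ∣ insertAt S i false ∣ ≡ ∣ S ∣
∣insertAt-false∣ S           zero    = refl
∣insertAt-false∣ (true ∷ S)  (suc i) = cong suc (∣insertAt-false∣ S i)
∣insertAt-false∣ (false ∷ S) (suc i) = ∣insertAt-false∣ S i

∈-insertAt-true : ∀ {n} (S : Subset n) i → i ∈ insertAt S i true
∈-insertAt-true S       zero    = here
∈-insertAt-true (b ∷ S) (suc i) = there (∈-insertAt-true S i)

punchIn-∈-insertAt : ∀ {n} {S : Subset n} i {j} b → j ∈ S → punchIn i j ∈ insertAt S i b
punchIn-∈-insertAt zero    b j∈S         = there j∈S
punchIn-∈-insertAt (suc i) b here        = here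
punchIn-∈-insertAt (suc i) b (there j∈S) = there (punchIn-∈-insertAt i b j∈S)

insertAt-⊆ : ∀ {n} {S T : Subset n} i b → S ⊆ T → insertAt S i b ⊆ insertAt T i b
insertAt-⊆ zero b S⊆T here = here
insertAt-⊆ zero b S⊆T (there x∈S) = there (S⊆T x∈S)
insertAt-⊆ {S = _ ∷ _} {_ ∷ _} (suc i) b S⊆T here with S⊆T here
... | here = here
insertAt-⊆ {S = _ ∷ _} {_ ∷ _} (suc i) b S⊆T (there x∈S) = there (insertAt-⊆ i b (drop-∷-⊆ S⊆T) x∈S)

∪-absorbs-∈ : ∀ {n} {S : Subset n} {z} → z ∈ S → S ∪ ⁅ z ⁆ ≡ S
∪-absorbs-∈ {S = S} {z} z∈S = ⊆-antisym
  (λ x∈ → [ id , (λ x∈z → subst (_∈ S) (sym (x∈⁅y⁆⇒x≡y z x∈z)) z∈S) ] (x∈p∪q⁻ S ⁅ z ⁆ x∈))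
  (p⊆p∪q ⁅ z ⁆)

∈-image⁺ : ∀ {k n} (f : Fin k → Fin n) {S y} → y ∈ S → f y ∈ image f S
∈-image⁺ f {true ∷ S} here        = p⊆p∪q (image (f ∘ suc) S) (x∈⁅x⁆ (f zero))
∈-image⁺ f {b ∷ S}    (there y∈S) = q⊆p∪q (if b then ⁅ f zero ⁆ else ⊥) _ (∈-image⁺ (f ∘ suc) y∈S)

∈-image⁻ : ∀ {k n} (f : Fin k → Fin n) (S : Subset k) {x} → x ∈ image f S → ∃[ y ] (y ∈ S × f y ≡ x)
∈-image⁻ f []      x∈ = ⊥-elim (∉⊥ x∈)
∈-image⁻ f (b ∷ S) {x} x∈ with x∈p∪q⁻ (if b then ⁅ f zero ⁆ else ⊥) _ x∈
∈-image⁻ f (true ∷ S)  x∈ | inj₁ x∈fz = zero , here , sym (x∈⁅y⁆⇒x≡y (f zero) x∈fz)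
∈-image⁻ f (false ∷ S) x∈ | inj₁ x∈⊥  = ⊥-elim (∉⊥ x∈⊥)
∈-image⁻ f (b ∷ S)     x∈ | inj₂ x∈fS with ∈-image⁻ (f ∘ suc) S x∈fS
... | y , y∈S , fy≡x = suc y , there y∈S , fy≡x

image-⊆ : ∀ {k n} (f : Fin k → Fin n) {S T} → (∀ {y} → y ∈ S → f y ∈ T) → image f S ⊆ T
image-⊆ f {S} {T} h x∈ with ∈-image⁻ f S x∈
... | y , y∈S , refl = h y∈S

image-∪ : ∀ {k n} (f : Fin k → Fin n) S T → image f (S ∪ T) ≡ image f S ∪ image f T
image-∪ f S T = ⊆-antisym
  (image-⊆ f λ {y} y∈ → [ p⊆p∪q _ ∘ ∈-image⁺ f , q⊆p∪q _ _ ∘ ∈-image⁺ f ] (x∈p∪q⁻ S T y∈))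
  (λ x∈ → [ image-⊆ f (∈-image⁺ f ∘ p⊆p∪q T) , image-⊆ f (∈-image⁺ f ∘ q⊆p∪q S T) ]
            (x∈p∪q⁻ (image f S) (image f T) x∈))

image-⁅⁆ : ∀ {k n} (f : Fin k → Fin n) x → image f ⁅ x ⁆ ≡ ⁅ f x ⁆
image-⁅⁆ f x = ⊆-antisym
  (image-⊆ f λ {y} y∈ → subst (λ z → f z ∈ ⁅ f x ⁆) (sym (x∈⁅y⁆⇒x≡y x y∈)) (x∈⁅x⁆ (f x)))
  (λ {z} z∈ → subst (_∈ image f ⁅ x ⁆) (sym (x∈⁅y⁆⇒x≡y (f x) z∈)) (∈-image⁺ f (x∈⁅x⁆ x)))

image-id : ∀ {n} (S : Subset n) → image id S ≡ S
image-id S = ⊆-antisym (image-⊆ id id) (∈-image⁺ id)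

image-∘ : ∀ {j k n} (f : Fin k → Fin n) (g : Fin j → Fin k) S → image (f ∘ g) S ≡ image f (image g S)
image-∘ f g S = ⊆-antisym
  (image-⊆ (f ∘ g) (∈-image⁺ f ∘ ∈-image⁺ g))
  (image-⊆ f (λ {y} y∈ → let (z , z∈S , gz≡y) = ∈-image⁻ g S y∈ in
                          subst (λ w → f w ∈ image (f ∘ g) S) gz≡y (∈-image⁺ (f ∘ g) z∈S)))

image-cong : ∀ {k n} {f g : Fin k → Fin n} → (∀ x → f x ≡ g x) → ∀ S → image f S ≡ image g S
image-cong {zero}  f≗g []      = refl
image-cong {suc k} f≗g (b ∷ S) =
  cong₂ _∪_ (cong (λ y → if b then ⁅ y ⁆ else ⊥) (f≗g zero)) (image-cong (f≗g ∘ suc) S)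

image-to∘from : ∀ {k n} (σ : Fin k ↔ Fin n) S → image (Inverse.to σ) (image (Inverse.from σ) S) ≡ S
image-to∘from σ S = trans (sym (image-∘ to from S)) (trans (image-cong strictlyInverseˡ S) (image-id S))
  where open Inverse σ

image-from∘to : ∀ {k n} (σ : Fin k ↔ Fin n) S → image (Inverse.from σ) (image (Inverse.to σ) S) ≡ S
image-from∘to σ S = trans (sym (image-∘ from to S)) (trans (image-cong strictlyInverseʳ S) (image-id S))
  where open Inverse σ

image-insertAt-false : ∀ {k n} (f : Fin (suc k) → Fin n) i S →
                       image f (insertAt S i false) ≡ image (f ∘ punchIn i) S
image-insertAt-false f zero    S       = ∪-identityˡ (image (f ∘ suc) S)
image-insertAt-false f (suc i) (b ∷ S) = cong (_ ∪_) (image-insertAt-false (f ∘ suc) i S)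

insertAt-false-image : ∀ {n} (S : Subset n) w → insertAt S w false ≡ image (punchIn w) S
insertAt-false-image S w = trans (sym (image-id _)) (image-insertAt-false id w S)

image-insertAt-true : ∀ {k n} (f : Fin (suc k) → Fin n) i S →
                      image f (insertAt S i true) ≡ ⁅ f i ⁆ ∪ image (f ∘ punchIn i) S
image-insertAt-true f i S = begin
  image f (insertAt S i true)                  ≡⟨ cong (image f) (insertAt-true S i) ⟩
  image f (⁅ i ⁆ ∪ insertAt S i false)         ≡⟨ image-∪ f ⁅ i ⁆ _ ⟩
  image f ⁅ i ⁆ ∪ image f (insertAt S i false) ≡⟨ cong₂ _∪_ (image-⁅⁆ f i) (image-insertAt-false f i S) ⟩
  ⁅ f i ⁆ ∪ image (f ∘ punchIn i) S            ∎
  where open ≡-Reasoning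

insertAt-∪-⁅⁆ : ∀ {n} (S : Subset n) i b j → insertAt (S ∪ ⁅ j ⁆) i b ≡ insertAt S i b ∪ ⁅ punchIn i j ⁆
insertAt-∪-⁅⁆ S i true  j = trans (insertAt-∪ S ⁅ j ⁆ i true false) (cong (_ ∪_) (insertAt-⁅⁆ i j))
insertAt-∪-⁅⁆ S i false j = trans (insertAt-∪ S ⁅ j ⁆ i false false) (cong (_ ∪_) (insertAt-⁅⁆ i j))

subsetOf : ∀ {n} {P : Fin n → Set} → Decidable P → Subset n
subsetOf P? = tabulate (does ∘ P?)

∈-subsetOf⁺ : ∀ {n} {P : Fin n → Set} (P? : Decidable P) {i} → P i → i ∈ subsetOf P?
∈-subsetOf⁺ P? {zero} p with P? zero
... | yes _  = here
... | no ¬p  = ⊥-elim (¬p p)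
∈-subsetOf⁺ P? {suc i} p = there (∈-subsetOf⁺ (P? ∘ suc) p)

∈-subsetOf⁻ : ∀ {n} {P : Fin n → Set} (P? : Decidable P) {i} → i ∈ subsetOf P? → P i
∈-subsetOf⁻ P? {zero} i∈ with P? zero | i∈
... | yes p | _ = p
∈-subsetOf⁻ P? {suc i} (there i∈) = ∈-subsetOf⁻ (P? ∘ suc) i∈

-- Rank functions of matroids and their minors

∸-+-∸ : ∀ {a b c} → c ≤ a → c ≤ b → (a ∸ c) + (b ∸ c) ≡ (a + b) ∸ (c + c)
∸-+-∸ {a} {b} {c} c≤a c≤b = begin
  (a ∸ c) + (b ∸ c)  ≡⟨ +-∸-assoc (a ∸ c) c≤b ⟨
  (a ∸ c + b) ∸ c    ≡⟨ cong (_∸ c) (+-∸-comm b c≤a) ⟨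
  (a + b) ∸ c ∸ c    ≡⟨ ∸-+-assoc (a + b) c c ⟩
  (a + b) ∸ (c + c)  ∎
  where open ≡-Reasoning

module _ {n} {r : Rank n} (mat : IsMatroid r) where
  open IsMatroid mat

  rank-∪-≤ : ∀ A B → r (A ∪ B) ≤ r A + r B
  rank-∪-≤ A B = ≤-trans (m≤m+n (r (A ∪ B)) (r (A ∩ B))) (r-submod A B)

  rank-∪ˡ : ∀ A B → r A ≤ r (A ∪ B)
  rank-∪ˡ A B = r-mono (p⊆p∪q B)

  rank-∪ʳ : ∀ A B → r B ≤ r (A ∪ B)
  rank-∪ʳ A B = r-mono (q⊆p∪q A B)

  rank-⁅⁆-≤1 : ∀ x → r ⁅ x ⁆ ≤ 1
  rank-⁅⁆-≤1 x = subst (r ⁅ x ⁆ ≤_) (∣⁅x⁆∣≡1 x) (r-≤-card ⁅ x ⁆)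

  rank-⁅⁆-loop-or-1 : ∀ x → IsLoop r x ⊎ r ⁅ x ⁆ ≡ 1
  rank-⁅⁆-loop-or-1 x with r ⁅ x ⁆ | rank-⁅⁆-≤1 x
  ... | zero  | _       = inj₁ refl
  ... | suc _ | s≤s z≤n = inj₂ refl

  rank-pair-≤2 : ∀ x y → r (⁅ x ⁆ ∪ ⁅ y ⁆) ≤ 2
  rank-pair-≤2 x y = ≤-trans (rank-∪-≤ ⁅ x ⁆ ⁅ y ⁆) (+-mono-≤ (rank-⁅⁆-≤1 x) (rank-⁅⁆-≤1 y))

  rank-∪⁅⁆-≤ : ∀ S x → r (S ∪ ⁅ x ⁆) ≤ suc (r S)
  rank-∪⁅⁆-≤ S x = ≤-trans (rank-∪-≤ S ⁅ x ⁆)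
    (subst (r S + r ⁅ x ⁆ ≤_) (+-comm (r S) 1) (+-monoʳ-≤ (r S) (rank-⁅⁆-≤1 x)))

  rank-∪-loop : ∀ S {x} → IsLoop r x → r (S ∪ ⁅ x ⁆) ≡ r S
  rank-∪-loop S {x} loop = ≤-antisym
    (subst (r (S ∪ ⁅ x ⁆) ≤_) (trans (cong (r S +_) loop) (+-identityʳ (r S))) (rank-∪-≤ S ⁅ x ⁆))
    (rank-∪ˡ S ⁅ x ⁆)

  rank-pair-1-or-2 : ∀ {x} y → r ⁅ x ⁆ ≡ 1 → r (⁅ x ⁆ ∪ ⁅ y ⁆) ≡ 1 ⊎ r (⁅ x ⁆ ∪ ⁅ y ⁆) ≡ 2
  rank-pair-1-or-2 {x} y rank-x
    with r (⁅ x ⁆ ∪ ⁅ y ⁆) | subst (_≤ r (⁅ x ⁆ ∪ ⁅ y ⁆)) rank-x (rank-∪ˡ ⁅ x ⁆ ⁅ y ⁆) | rank-pair-≤2 x y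
  ... | suc zero          | _ | _            = inj₁ refl
  ... | suc (suc zero)    | _ | _            = inj₂ refl
  ... | suc (suc (suc _)) | _ | s≤s (s≤s ())

  rank-1⇒parallel : ∀ {x y} → x ≢ y → r ⁅ x ⁆ ≡ 1 → r ⁅ y ⁆ ≡ 1 → r (⁅ x ⁆ ∪ ⁅ y ⁆) ≡ 1 →
                    Parallel r x y
  rank-1⇒parallel x≢y rank-x rank-y rank-xy =
    x≢y , subst (0 <_) (sym rank-x) (s≤s z≤n) , trans rank-x (sym rank-y) , trans rank-y (sym rank-xy)

delete-isMatroid : ∀ {n} {r : Rank (suc n)} i → IsMatroid r → IsMatroid (delete i r)
delete-isMatroid {r = r} i mat = record
  { r-∅      = trans (cong r (insertAt-⊥ i)) r-∅
  ; r-mono   = λ S⊆T → r-mono (insertAt-⊆ i false S⊆T)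
  ; r-submod = λ S T → subst₂ (λ A B → r A + r B ≤ r (insertAt S i false) + r (insertAt T i false))
                 (sym (insertAt-∪ S T i false false)) (sym (insertAt-∩ S T i false false))
                 (r-submod (insertAt S i false) (insertAt T i false))
  ; r-≤-card = λ S → subst (r (insertAt S i false) ≤_) (∣insertAt-false∣ S i) (r-≤-card (insertAt S i false))
  }
  where open IsMatroid mat

contract-isMatroid : ∀ {n} {r : Rank (suc n)} i → IsMatroid r → IsMatroid (contract i r)
contract-isMatroid {r = r} i mat = record
  { r-∅      = trans (cong (λ S → r S ∸ r ⁅ i ⁆) (insertAt-⊥-true i)) (n∸n≡0 (r ⁅ i ⁆))
  ; r-mono   = λ S⊆T → ∸-monoˡ-≤ (r ⁅ i ⁆) (r-mono (insertAt-⊆ i true S⊆T))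
  ; r-submod = λ S T → subst₂ _≤_ (sym (∸-+-∸ (i≤ (S ∪ T)) (i≤ (S ∩ T)))) (sym (∸-+-∸ (i≤ S) (i≤ T)))
                 (∸-monoˡ-≤ (r ⁅ i ⁆ + r ⁅ i ⁆)
                   (subst₂ (λ A B → r A + r B ≤ r (insertAt S i true) + r (insertAt T i true))
                     (sym (insertAt-∪ S T i true true)) (sym (insertAt-∩ S T i true true))
                     (r-submod (insertAt S i true) (insertAt T i true))))
  ; r-≤-card = λ S → m≤n+o⇒m∸n≤o _ (r ⁅ i ⁆) (≤-trans
                 (subst (λ A → r A ≤ r ⁅ i ⁆ + r (insertAt S i false)) (sym (insertAt-true S i))
                   (rank-∪-≤ mat ⁅ i ⁆ (insertAt S i false)))
                 (+-monoʳ-≤ (r ⁅ i ⁆) (subst (r (insertAt S i false) ≤_) (∣insertAt-false∣ S i) (r-≤-card _))))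
  }
  where
  open IsMatroid mat
  i≤ : ∀ S → r ⁅ i ⁆ ≤ r (insertAt S i true)
  i≤ S = r-mono λ x∈ → subst (_∈ insertAt S i true) (sym (x∈⁅y⁆⇒x≡y i x∈)) (∈-insertAt-true S i)

-- Group representations exclude U₂,₃ minors

^-quotient : ∀ {m a b x} → 2 ≤ m → 1 ≤ x → m ^ a ≡ m ^ b * x → x ≡ m ^ (a ∸ b)
^-quotient {m@(suc _)} {a} {b} {x} 2≤m 1≤x eq =
  *-cancelˡ-≡ x (m ^ (a ∸ b)) (m ^ b) {{m^n≢0 m b}} (begin
    m ^ b * x            ≡⟨ eq ⟨
    m ^ a                ≡⟨ cong (m ^_) (m+[n∸m]≡n b≤a) ⟨
    m ^ (b + (a ∸ b))    ≡⟨ ^-distribˡ-+-* m b (a ∸ b) ⟩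
    m ^ b * m ^ (a ∸ b)  ∎)
  where
  open ≡-Reasoning
  b≤a : b ≤ a
  b≤a with ≤-<-connex b a
  ... | inj₁ b≤a = b≤a
  ... | inj₂ a<b = ⊥-elim (<-irrefl eq (<-≤-trans (^-monoʳ-< m 2≤m a<b)
                    (subst (_≤ m ^ b * x) (*-identityʳ (m ^ b)) (*-monoʳ-≤ (m ^ b) 1≤x))))

_≟ᵖ_ : ∀ {m k} → DecidableEquality (Vec (Maybe (Fin m)) k)
_≟ᵖ_ = VecP.≡-dec (MaybeP.≡-dec _≟_)

proj-≡⁺ : ∀ {m k} (S : Subset k) {v w : Vec (Fin m) k} →
          (∀ {i} → i ∈ S → lookup v i ≡ lookup w i) → proj S v ≡ proj S w
proj-≡⁺ []          {[]}    {[]}    _  = refl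
proj-≡⁺ (true ∷ S)  {_ ∷ _} {_ ∷ _} eq = cong₂ _∷_ (cong just (eq here)) (proj-≡⁺ S (eq ∘ there))
proj-≡⁺ (false ∷ S) {_ ∷ _} {_ ∷ _} eq = cong (nothing ∷_) (proj-≡⁺ S (eq ∘ there))

proj-≡⁻ : ∀ {m k} {S : Subset k} {v w : Vec (Fin m) k} → proj S v ≡ proj S w →
          ∀ {i} → i ∈ S → lookup v i ≡ lookup w i
proj-≡⁻ {S = _ ∷ _} {_ ∷ _} {_ ∷ _} eq here        = just-injective (VecP.∷-injectiveˡ eq)
proj-≡⁻ {S = _ ∷ _} {_ ∷ _} {_ ∷ _} eq (there i∈S) = proj-≡⁻ (VecP.∷-injectiveʳ eq) i∈S

lookup-proj-∈ : ∀ {m k} {S : Subset k} (v : Vec (Fin m) k) {i} → i ∈ S → lookup (proj S v) i ≡ just (lookup v i)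
lookup-proj-∈ (_ ∷ _) here        = refl
lookup-proj-∈ (_ ∷ v) (there i∈S) = lookup-proj-∈ v i∈S

nonAbelian⇒2≤order : ∀ {m} (Γ : FinGroup m) → NonAbelian Γ → 2 ≤ m
nonAbelian⇒2≤order {suc zero}    Γ (zero , zero , xy≢yx) = ⊥-elim (xy≢yx refl)
nonAbelian⇒2≤order {suc (suc _)} Γ _                     = s≤s (s≤s z≤n)

asGroup : ∀ {m} → FinGroup m → Group 0ℓ 0ℓ
asGroup Γ = record { isGroup = FinGroup.isGroup Γ }

module Pointwise {m} (Γ : FinGroup m) where
  open FinGroup Γ

  infixl 7 _∙ᵛ_
  _∙ᵛ_ : ∀ {k} → Vec (Fin m) k → Vec (Fin m) k → Vec (Fin m) k
  _∙ᵛ_ = zipWith _∙_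

  _⁻¹ᵛ : ∀ {k} → Vec (Fin m) k → Vec (Fin m) k
  _⁻¹ᵛ = Vec.map _⁻¹

  εᵛ : ∀ {k} → Vec (Fin m) k
  εᵛ {k} = replicate k ε

  lookup-∙ᵛ : ∀ {k} (u v : Vec (Fin m) k) i → lookup (u ∙ᵛ v) i ≡ lookup u i ∙ lookup v i
  lookup-∙ᵛ u v i = VecP.lookup-zipWith _∙_ i u v

  lookup-⁻¹ᵛ : ∀ {k} (u : Vec (Fin m) k) i → lookup (u ⁻¹ᵛ) i ≡ lookup u i ⁻¹
  lookup-⁻¹ᵛ u i = VecP.lookup-map i _⁻¹ u

  lookup-εᵛ : ∀ {k} i → lookup (εᵛ {k}) i ≡ ε
  lookup-εᵛ i = VecP.lookup-replicate i ε

module _ {m} (Γ : FinGroup m) where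
  open FinGroup Γ
  open IsGroup isGroup using (identityˡ; identityʳ; inverseˡ)
  open GroupProperties (asGroup Γ) using (∙-cancelˡ; ε⁻¹≈ε)
  open Pointwise Γ
  open Subgroup

  projCard-pos : ∀ {k} (H : Subgroup Γ k) S → 1 ≤ projCard H S
  projCard-pos H S = card-pos _≟ᵖ_ (∈-map⁺ (proj S) (has-ε H))

  kernel : ∀ {k} → Subgroup Γ k → Fin k → Subgroup Γ k
  kernel H c = record
    { elems     = filter c-trivial? (elems H)
    ; has-ε     = ∈-filter⁺ c-trivial? (has-ε H) (lookup-εᵛ c)
    ; closed-∙  = λ {u} {v} u∈ v∈ →
        let (u∈H , uc) = ∈-filter⁻ c-trivial? u∈ ; (v∈H , vc) = ∈-filter⁻ c-trivial? v∈ in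
        ∈-filter⁺ c-trivial? (closed-∙ H u∈H v∈H)
          (trans (lookup-∙ᵛ u v c) (trans (cong₂ _∙_ uc vc) (identityˡ ε)))
    ; closed-⁻¹ = λ {u} u∈ →
        let (u∈H , uc) = ∈-filter⁻ c-trivial? u∈ in
        ∈-filter⁺ c-trivial? (closed-⁻¹ H u∈H) (trans (lookup-⁻¹ᵛ u c) (trans (cong _⁻¹ uc) ε⁻¹≈ε))
    }
    where
    c-trivial? : ∀ h → Dec (lookup h c ≡ ε)
    c-trivial? h = lookup h c ≟ ε

  ∈-kernel⁻ : ∀ {k} (H : Subgroup Γ k) c {h} → h ∈ₗ elems (kernel H c) → h ∈ₗ elems H × lookup h c ≡ ε
  ∈-kernel⁻ H c = ∈-filter⁻ (λ h → lookup h c ≟ ε)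

  ∈-kernel⁺ : ∀ {k} (H : Subgroup Γ k) c {h} → h ∈ₗ elems H → lookup h c ≡ ε → h ∈ₗ elems (kernel H c)
  ∈-kernel⁺ H c = ∈-filter⁺ (λ h → lookup h c ≟ ε)

  -- With H_c the kernel of the c-th coordinate, (u , w) ↦ π_{c ∪ T}(h_u · k_w), for chosen preimages
  -- h_u ∈ H of u and k_w ∈ H_c of w, is a bijection π_c(H) × π_T(H_c) → π_{c ∪ T}(H).
  module ContractionFormula {k} (H : Subgroup Γ k) (c : Fin k) (T : Subset k) where
    MV : Set
    MV = Vec (Maybe (Fin m)) k

    C : Subset k
    C = ⁅ c ⁆

    hs ks : List (Vec (Fin m) k)
    hs = elems H
    ks = elems (kernel H c)

    πC πT πCT : List MV
    πC  = deduplicate _≟ᵖ_ (map (proj C) hs)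
    πT  = deduplicate _≟ᵖ_ (map (proj T) ks)
    πCT = map (proj (C ∪ T)) hs

    pairs : List (MV × MV)
    pairs = cartesianProduct πC πT

    liftC : MV → Vec (Fin m) k
    liftC = preimage _≟ᵖ_ (proj C) εᵛ hs

    liftT : MV → Vec (Fin m) k
    liftT = preimage _≟ᵖ_ (proj T) εᵛ ks

    liftCT : MV → Vec (Fin m) k
    liftCT = preimage _≟ᵖ_ (proj (C ∪ T)) εᵛ hs

    liftC-spec : ∀ {u} → u ∈ₗ πC → liftC u ∈ₗ hs × proj C (liftC u) ≡ u
    liftC-spec u∈ = preimage-spec _≟ᵖ_ (proj C) εᵛ (∈-deduplicate⁻ _≟ᵖ_ _ u∈)

    liftT-spec : ∀ {w} → w ∈ₗ πT → liftT w ∈ₗ ks × proj T (liftT w) ≡ w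
    liftT-spec w∈ = preimage-spec _≟ᵖ_ (proj T) εᵛ (∈-deduplicate⁻ _≟ᵖ_ _ w∈)

    liftT-c : ∀ {w} → w ∈ₗ πT → lookup (liftT w) c ≡ ε
    liftT-c w∈ = proj₂ (∈-kernel⁻ H c (proj₁ (liftT-spec w∈)))

    c∈CT : c ∈ C ∪ T
    c∈CT = p⊆p∪q T (x∈⁅x⁆ c)

    proj-C-≡ : ∀ {v w : Vec (Fin m) k} → lookup v c ≡ lookup w c → proj C v ≡ proj C w
    proj-C-≡ {v} {w} eq = proj-≡⁺ C λ i∈C → subst (λ i → lookup v i ≡ lookup w i) (sym (x∈⁅y⁆⇒x≡y c i∈C)) eq

    combine : MV × MV → MV
    combine (u , w) = proj (C ∪ T) (liftC u ∙ᵛ liftT w)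

    combine-into : MapsInto combine pairs πCT
    combine-into p∈ = let (u∈ , w∈) = ∈-cartesianProduct⁻ πC πT p∈ in
      ∈-map⁺ (proj (C ∪ T)) (closed-∙ H (proj₁ (liftC-spec u∈)) (proj₁ (∈-kernel⁻ H c (proj₁ (liftT-spec w∈)))))

    combine-injective : InjectiveOn combine pairs
    combine-injective {u , w} {u′ , w′} p∈ p′∈ eq
      with ∈-cartesianProduct⁻ πC πT p∈ | ∈-cartesianProduct⁻ πC πT p′∈
    ... | u∈ , w∈ | u′∈ , w′∈ = cong₂ _,_ u≡u′ (w≡w′ u≡u′)
      where
      agree : ∀ {i} → i ∈ C ∪ T → lookup (liftC u ∙ᵛ liftT w) i ≡ lookup (liftC u′ ∙ᵛ liftT w′) i
      agree = proj-≡⁻ eq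
      lifts-agree-at-c : lookup (liftC u) c ≡ lookup (liftC u′) c
      lifts-agree-at-c = begin
        lookup (liftC u) c                          ≡⟨ identityʳ _ ⟨
        lookup (liftC u) c ∙ ε                      ≡⟨ cong (_ ∙_) (liftT-c w∈) ⟨
        lookup (liftC u) c ∙ lookup (liftT w) c     ≡⟨ lookup-∙ᵛ (liftC u) (liftT w) c ⟨
        lookup (liftC u ∙ᵛ liftT w) c               ≡⟨ agree c∈CT ⟩
        lookup (liftC u′ ∙ᵛ liftT w′) c             ≡⟨ lookup-∙ᵛ (liftC u′) (liftT w′) c ⟩
        lookup (liftC u′) c ∙ lookup (liftT w′) c   ≡⟨ cong (_ ∙_) (liftT-c w′∈) ⟩
        lookup (liftC u′) c ∙ ε                     ≡⟨ identityʳ _ ⟩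
        lookup (liftC u′) c                         ∎
        where open ≡-Reasoning
      u≡u′ : u ≡ u′
      u≡u′ = trans (sym (proj₂ (liftC-spec u∈))) (trans (proj-C-≡ lifts-agree-at-c) (proj₂ (liftC-spec u′∈)))
      w≡w′ : u ≡ u′ → w ≡ w′
      w≡w′ refl = trans (sym (proj₂ (liftT-spec w∈))) (trans (proj-≡⁺ T λ i∈T →
        ∙-cancelˡ (lookup (liftC u) _) _ _ (trans (sym (lookup-∙ᵛ (liftC u) (liftT w) _))
          (trans (agree (q⊆p∪q C T i∈T)) (lookup-∙ᵛ (liftC u) (liftT w′) _)))) (proj₂ (liftT-spec w′∈)))

    split : MV → MV × MV
    split v = proj C h , proj T (liftC (proj C h) ⁻¹ᵛ ∙ᵛ h)
      where h = liftCT v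

    liftCT-spec : ∀ {v} → v ∈ₗ πCT → liftCT v ∈ₗ hs × proj (C ∪ T) (liftCT v) ≡ v
    liftCT-spec = preimage-spec _≟ᵖ_ (proj (C ∪ T)) εᵛ

    split-into : MapsInto split πCT pairs
    split-into {v} v∈ = ∈-cartesianProduct⁺ u∈ (∈-deduplicate⁺ _≟ᵖ_ (∈-map⁺ (proj T) quotient∈K))
      where
      h h′ : Vec (Fin m) k
      h = liftCT v
      h′ = liftC (proj C h)
      h∈H : h ∈ₗ hs
      h∈H = proj₁ (liftCT-spec v∈)
      u∈ : proj C h ∈ₗ πC
      u∈ = ∈-deduplicate⁺ _≟ᵖ_ (∈-map⁺ (proj C) h∈H)
      h′-c : lookup h′ c ≡ lookup h c
      h′-c = proj-≡⁻ (proj₂ (liftC-spec u∈)) (x∈⁅x⁆ c)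
      quotient∈K : h′ ⁻¹ᵛ ∙ᵛ h ∈ₗ ks
      quotient∈K = ∈-kernel⁺ H c (closed-∙ H (closed-⁻¹ H (proj₁ (liftC-spec u∈))) h∈H)
        (trans (lookup-∙ᵛ (h′ ⁻¹ᵛ) h c)
          (trans (cong (_∙ lookup h c) (trans (lookup-⁻¹ᵛ h′ c) (cong _⁻¹ h′-c))) (inverseˡ (lookup h c))))

    split-injective : InjectiveOn split πCT
    split-injective {v} {v′} v∈ v′∈ eq =
      trans (sym (proj₂ (liftCT-spec v∈))) (trans (proj-≡⁺ (C ∪ T) agree) (proj₂ (liftCT-spec v′∈)))
      where
      h h′ : Vec (Fin m) k
      h = liftCT v
      h′ = liftCT v′
      agree-T : ∀ {u} → u ≡ proj C h′ →
                proj T (liftC u ⁻¹ᵛ ∙ᵛ h) ≡ proj T (liftC (proj C h′) ⁻¹ᵛ ∙ᵛ h′) →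
                ∀ {i} → i ∈ T → lookup h i ≡ lookup h′ i
      agree-T refl eqT {i} i∈T = ∙-cancelˡ (lookup a i) _ _
        (trans (sym (lookup-∙ᵛ a h i)) (trans (proj-≡⁻ eqT i∈T) (lookup-∙ᵛ a h′ i)))
        where
        a : Vec (Fin m) k
        a = liftC (proj C h′) ⁻¹ᵛ
      agree : ∀ {i} → i ∈ C ∪ T → lookup h i ≡ lookup h′ i
      agree {i} i∈ with x∈p∪q⁻ C T i∈
      ... | inj₁ i∈C = subst (λ j → lookup h j ≡ lookup h′ j) (sym (x∈⁅y⁆⇒x≡y c i∈C))
                         (proj-≡⁻ (cong proj₁ eq) (x∈⁅x⁆ c))
      ... | inj₂ i∈T = agree-T (cong proj₁ eq) (cong proj₂ eq) i∈T

    _≟ᵖᵖ_ : DecidableEquality (MV × MV)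
    _≟ᵖᵖ_ = ProductP.≡-dec _≟ᵖ_ _≟ᵖ_

    pairs-unique : Unique pairs
    pairs-unique =
      UniqueP.cartesianProduct⁺ (deduplicate-! _≟ᵖ_ (map (proj C) hs)) (deduplicate-! _≟ᵖ_ (map (proj T) ks))

    projCard-⁅⁆-∪ : projCard H (C ∪ T) ≡ projCard H C * projCard (kernel H c) T
    projCard-⁅⁆-∪ = begin
      projCard H (C ∪ T)   ≡⟨ ≤-antisym (card-≤-injection _≟ᵖ_ _≟ᵖᵖ_ split split-into split-injective)
                                        (card-≤-injection _≟ᵖᵖ_ _≟ᵖ_ combine combine-into combine-injective) ⟩
      card _≟ᵖᵖ_ pairs     ≡⟨ card-unique _≟ᵖᵖ_ pairs-unique ⟩
      length pairs         ≡⟨ length-cartesianProductWith _,_ πC πT ⟩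
      projCard H C * projCard (kernel H c) T ∎
      where open ≡-Reasoning

  open ContractionFormula using (projCard-⁅⁆-∪) public

  module _ {k} (H : Subgroup Γ k) (c : Fin k) where

    coordinates : List (Fin m)
    coordinates = map (λ h → lookup h c) (elems H)

    projCard-⁅⁆ : projCard H ⁅ c ⁆ ≡ card _≟_ coordinates
    projCard-⁅⁆ = card-≡-inverse _≟ᵖ_ _≟_ read write read-into write-into write-read read-write
      where
      read : Vec (Maybe (Fin m)) k → Fin m
      read u = fromMaybe ε (lookup u c)
      write : Fin m → Vec (Maybe (Fin m)) k
      write α = proj ⁅ c ⁆ (replicate k α)
      read-proj : ∀ h → read (proj ⁅ c ⁆ h) ≡ lookup h c
      read-proj h = cong (fromMaybe ε) (lookup-proj-∈ h (x∈⁅x⁆ c))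
      write-lookup : ∀ h → write (lookup h c) ≡ proj ⁅ c ⁆ h
      write-lookup h = proj-≡⁺ ⁅ c ⁆ λ i∈ → subst (λ i → lookup (replicate k (lookup h c)) i ≡ lookup h i)
        (sym (x∈⁅y⁆⇒x≡y c i∈)) (VecP.lookup-replicate c (lookup h c))
      read-into : MapsInto read (map (proj ⁅ c ⁆) (elems H)) coordinates
      read-into u∈ with ∈-map⁻ (proj ⁅ c ⁆) u∈
      ... | h , h∈ , refl = subst (_∈ₗ coordinates) (sym (read-proj h)) (∈-map⁺ (λ h → lookup h c) h∈)
      write-into : MapsInto write coordinates (map (proj ⁅ c ⁆) (elems H))
      write-into α∈ with ∈-map⁻ (λ h → lookup h c) α∈
      ... | h , h∈ , refl = subst (_∈ₗ map (proj ⁅ c ⁆) (elems H)) (sym (write-lookup h)) (∈-map⁺ (proj ⁅ c ⁆) h∈)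
      write-read : ∀ {u} → u ∈ₗ map (proj ⁅ c ⁆) (elems H) → write (read u) ≡ u
      write-read u∈ with ∈-map⁻ (proj ⁅ c ⁆) u∈
      ... | h , _ , refl = trans (cong write (read-proj h)) (write-lookup h)
      read-write : ∀ {α} → α ∈ₗ coordinates → read (write α) ≡ α
      read-write {α} _ = trans (read-proj (replicate k α)) (VecP.lookup-replicate c α)

    coordinate-surjective : projCard H ⁅ c ⁆ ≡ m → ∀ α → ∃[ h ] (h ∈ₗ elems H × lookup h c ≡ α)
    coordinate-surjective full α with ∈-map⁻ (λ h → lookup h c) (card-≡size⇒∈ (trans (sym projCard-⁅⁆) full) α)
    ... | h , h∈ , α≡hc = h , h∈ , sym α≡hc

    coordinate-trivial : projCard H ⁅ c ⁆ ≡ 1 → ∀ {h} → h ∈ₗ elems H → lookup h c ≡ ε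
    coordinate-trivial one {h} h∈ = trans
      (card-≡1⇒≡ _≟_ (trans (sym projCard-⁅⁆) one)
        (∈-map⁺ (λ h → lookup h c) h∈) (∈-map⁺ (λ h → lookup h c) (has-ε H)))
      (lookup-εᵛ c)

  projCard-kernel : 2 ≤ m → ∀ {k} (H : Subgroup Γ k) c T {a b} →
                    projCard H (⁅ c ⁆ ∪ T) ≡ m ^ a → projCard H ⁅ c ⁆ ≡ m ^ b →
                    projCard (kernel H c) T ≡ m ^ (a ∸ b)
  projCard-kernel 2≤m H c T {a} {b} cT c-only = ^-quotient {a = a} {b} 2≤m (projCard-pos (kernel H c) T)
    (trans (sym cT) (trans (projCard-⁅⁆-∪ H c T) (cong (_* projCard (kernel H c) T) c-only)))

  record Represents {k n} (H : Subgroup Γ k) (g : Fin n → Fin k) (r : Rank n) : Set where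
    constructor represents
    field projCard-image : ∀ S → projCard H (image g S) ≡ m ^ r S

  module _ {k n} {H : Subgroup Γ k} {g : Fin (suc n) → Fin k} {r : Rank (suc n)} where

    represents-delete : ∀ i → Represents H g r → Represents H (g ∘ punchIn i) (delete i r)
    represents-delete i (represents rep) = represents λ S →
      trans (cong (projCard H) (sym (image-insertAt-false g i S))) (rep (insertAt S i false))

    represents-contract : 2 ≤ m → ∀ i → Represents H g r →
                          Represents (kernel H (g i)) (g ∘ punchIn i) (contract i r)
    represents-contract 2≤m i (represents rep) = represents λ S →
      projCard-kernel 2≤m H (g i) (image (g ∘ punchIn i) S) {r (insertAt S i true)} {r ⁅ i ⁆}
      (trans (cong (projCard H) (sym (image-insertAt-true g i S))) (rep (insertAt S i true)))
      (trans (cong (projCard H) (sym (image-⁅⁆ g i))) (rep ⁅ i ⁆))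

  represents-iso : ∀ {k n n′} {H : Subgroup Γ k} {g : Fin n → Fin k} {r : Rank n} {u : Rank n′} →
                   Represents H g r → (iso : Isomorphic r u) → Represents H (g ∘ Inverse.from (proj₁ iso)) u
  represents-iso {H = H} {g} {r} {u} (represents rep) (σ , r≅u) = represents λ S → let open ≡-Reasoning in begin
    projCard H (image (g ∘ from) S)     ≡⟨ cong (projCard H) (image-∘ g from S) ⟩
    projCard H (image g (image from S)) ≡⟨ rep (image from S) ⟩
    m ^ r (image from S)                ≡⟨ cong (m ^_) (r≅u (image from S)) ⟨
    m ^ u (image to (image from S))     ≡⟨ cong (λ T → m ^ u T) (image-to∘from σ S) ⟩
    m ^ u S                             ∎
    where open Inverse σ using (to; from)

  commutator : ∀ {k} → Vec (Fin m) k → Vec (Fin m) k → Vec (Fin m) k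
  commutator a b = (b ∙ᵛ a) ⁻¹ᵛ ∙ᵛ (a ∙ᵛ b)

  lookup-commutator : ∀ {k} (a b : Vec (Fin m) k) i →
                      lookup (commutator a b) i ≡ ((lookup b i ∙ lookup a i) ⁻¹) ∙ (lookup a i ∙ lookup b i)
  lookup-commutator a b i = trans (lookup-∙ᵛ ((b ∙ᵛ a) ⁻¹ᵛ) (a ∙ᵛ b) i)
    (cong₂ _∙_ (trans (lookup-⁻¹ᵛ (b ∙ᵛ a) i) (cong _⁻¹ (lookup-∙ᵛ b a i))) (lookup-∙ᵛ a b i))

  ∙-comm-with-ε : ∀ {x y} → x ≡ ε ⊎ y ≡ ε → x ∙ y ≡ y ∙ x
  ∙-comm-with-ε (inj₁ refl) = trans (identityˡ _) (sym (identityʳ _))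
  ∙-comm-with-ε (inj₂ refl) = trans (identityʳ _) (sym (identityˡ _))

  commutator-trivial : ∀ {k} (a b : Vec (Fin m) k) i → lookup a i ≡ ε ⊎ lookup b i ≡ ε →
                       lookup (commutator a b) i ≡ ε
  commutator-trivial a b i trivial = trans (lookup-commutator a b i)
    (trans (cong (λ x → (x ⁻¹) ∙ (lookup a i ∙ lookup b i)) (sym (∙-comm-with-ε trivial))) (inverseˡ _))

  kernel-counts⇒commutative : ∀ {k} (H : Subgroup Γ k) p q s →
                              projCard (kernel H q) ⁅ s ⁆ ≡ m → projCard (kernel H p) ⁅ s ⁆ ≡ m →
                              projCard (kernel (kernel H p) q) ⁅ s ⁆ ≡ 1 → ∀ γ δ → γ ∙ δ ≡ δ ∙ γ
  kernel-counts⇒commutative H p q s Hq-s Hp-s Hpq-s γ δ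
    with coordinate-surjective (kernel H q) s Hq-s γ | coordinate-surjective (kernel H p) s Hp-s δ
  ... | h₁ , h₁∈Hq , h₁-s | h₂ , h₂∈Hp , h₂-s = ∙-cancelˡ ((δ ∙ γ) ⁻¹) _ _ (begin
    ((δ ∙ γ) ⁻¹) ∙ (γ ∙ δ)                                       ≡⟨ cong₂ (λ x y → ((y ∙ x) ⁻¹) ∙ (x ∙ y)) h₁-s h₂-s ⟨
    ((lookup h₂ s ∙ lookup h₁ s) ⁻¹) ∙ (lookup h₁ s ∙ lookup h₂ s) ≡⟨ lookup-commutator h₁ h₂ s ⟨
    lookup (commutator h₁ h₂) s                                  ≡⟨ coordinate-trivial Hpq s Hpq-s commutator∈Hpq ⟩
    ε                                                            ≡⟨ inverseˡ (δ ∙ γ) ⟨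
    ((δ ∙ γ) ⁻¹) ∙ (δ ∙ γ)                                       ∎)
    where
    open ≡-Reasoning
    h₁∈ : h₁ ∈ₗ elems H × lookup h₁ q ≡ ε
    h₁∈ = ∈-kernel⁻ H q h₁∈Hq
    h₂∈ : h₂ ∈ₗ elems H × lookup h₂ p ≡ ε
    h₂∈ = ∈-kernel⁻ H p h₂∈Hp
    Hpq : Subgroup Γ _
    Hpq = kernel (kernel H p) q
    commutator∈H : commutator h₁ h₂ ∈ₗ elems H
    commutator∈H = closed-∙ H (closed-⁻¹ H (closed-∙ H (proj₁ h₂∈) (proj₁ h₁∈))) (closed-∙ H (proj₁ h₁∈) (proj₁ h₂∈))
    commutator∈Hpq : commutator h₁ h₂ ∈ₗ elems Hpq
    commutator∈Hpq = ∈-kernel⁺ (kernel H p) q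
      (∈-kernel⁺ H p commutator∈H (commutator-trivial h₁ h₂ p (inj₂ (proj₂ h₂∈))))
      (commutator-trivial h₁ h₂ q (inj₁ (proj₂ h₁∈)))

  U₂,₃-represented⇒commutative : 2 ≤ m → ∀ {k} {H : Subgroup Γ k} {g : Fin 3 → Fin k} →
                                 Represents H g (U 2 3) → ∀ γ δ → γ ∙ δ ≡ δ ∙ γ
  U₂,₃-represented⇒commutative 2≤m {H = H} {g} (represents rep) =
    kernel-counts⇒commutative H p q s (trans Hq-s (*-identityʳ m)) (trans Hp-s (*-identityʳ m)) Hpq-s
    where
    p q s : Fin _
    p = g zero
    q = g (suc zero)
    s = g (suc (suc zero))
    pair : ∀ x y → image g (⁅ x ⁆ ∪ ⁅ y ⁆) ≡ ⁅ g x ⁆ ∪ ⁅ g y ⁆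
    pair x y = trans (image-∪ g ⁅ x ⁆ ⁅ y ⁆) (cong₂ _∪_ (image-⁅⁆ g x) (image-⁅⁆ g y))
    at : ∀ S {T} → image g S ≡ T → projCard H T ≡ m ^ U 2 3 S
    at S eq = trans (cong (projCard H) (sym eq)) (rep S)
    H-p : projCard H ⁅ p ⁆ ≡ m ^ 1
    H-p = at ⁅ zero ⁆ (image-⁅⁆ g zero)
    H-q : projCard H ⁅ q ⁆ ≡ m ^ 1
    H-q = at ⁅ suc zero ⁆ (image-⁅⁆ g (suc zero))
    Hp-q : projCard (kernel H p) ⁅ q ⁆ ≡ m ^ 1
    Hp-q = projCard-kernel 2≤m H p ⁅ q ⁆ {2} {1} (at (⁅ zero ⁆ ∪ ⁅ suc zero ⁆) (pair _ _)) H-p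
    Hp-s : projCard (kernel H p) ⁅ s ⁆ ≡ m ^ 1
    Hp-s = projCard-kernel 2≤m H p ⁅ s ⁆ {2} {1} (at (⁅ zero ⁆ ∪ ⁅ suc (suc zero) ⁆) (pair _ _)) H-p
    Hq-s : projCard (kernel H q) ⁅ s ⁆ ≡ m ^ 1
    Hq-s = projCard-kernel 2≤m H q ⁅ s ⁆ {2} {1} (at (⁅ suc zero ⁆ ∪ ⁅ suc (suc zero) ⁆) (pair _ _)) H-q
    Hp-qs : projCard (kernel H p) (⁅ q ⁆ ∪ ⁅ s ⁆) ≡ m ^ 1
    Hp-qs = projCard-kernel 2≤m H p (⁅ q ⁆ ∪ ⁅ s ⁆) {2} {1}
      (at (⁅ zero ⁆ ∪ ⁅ suc zero ⁆ ∪ ⁅ suc (suc zero) ⁆)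
        (trans (image-∪ g ⁅ zero ⁆ (⁅ suc zero ⁆ ∪ ⁅ suc (suc zero) ⁆))
          (cong₂ _∪_ (image-⁅⁆ g zero) (pair (suc zero) (suc (suc zero)))))) H-p
    Hpq-s : projCard (kernel (kernel H p) q) ⁅ s ⁆ ≡ 1
    Hpq-s = projCard-kernel 2≤m (kernel H p) q ⁅ s ⁆ {1} {1} Hp-qs Hp-q

  represents⇒¬U₂,₃-minor : NonAbelian Γ → ∀ {k n} {H : Subgroup Γ k} {g : Fin n → Fin k} {r : Rank n} →
                           Represents H g r → ¬ HasMinor r (U 2 3)
  represents⇒¬U₂,₃-minor nonAbelian@(γ , δ , γδ≢δγ) rep (iso r≅U₂,₃) =
    γδ≢δγ (U₂,₃-represented⇒commutative (nonAbelian⇒2≤order Γ nonAbelian) (represents-iso rep r≅U₂,₃) γ δ)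
  represents⇒¬U₂,₃-minor nonAbelian rep (del i minor) =
    represents⇒¬U₂,₃-minor nonAbelian (represents-delete i rep) minor
  represents⇒¬U₂,₃-minor nonAbelian rep (con i minor) =
    represents⇒¬U₂,₃-minor nonAbelian (represents-contract (nonAbelian⇒2≤order Γ nonAbelian) i rep) minor

  representable⇒¬U₂,₃-minor : NonAbelian Γ → ∀ {n} {r : Rank n} → Representable Γ r → ¬ HasMinor r (U 2 3)
  representable⇒¬U₂,₃-minor nonAbelian (_ , H , σ , rep) =
    represents⇒¬U₂,₃-minor nonAbelian (represents {H = H} {Inverse.to σ} rep)

-- Restrictions and triangles give U₂,₃ minors

Restriction : ∀ {n k} → Rank n → (Fin k → Fin n) → Rank k → Set
Restriction r τ u = ∀ T → r (image τ T) ≡ u T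

restriction-delete : ∀ {n k} {r : Rank (suc n)} {u : Rank k} (τ : Fin k → Fin (suc n)) w →
                     (avoid : ∀ j → w ≢ τ j) → Restriction r τ u →
                     Restriction (delete w r) (λ j → punchOut (avoid j)) u
restriction-delete {n} {k} {r} {u} τ w avoid res T = begin
  r (insertAt (image τ′ T) w false)   ≡⟨ cong r (insertAt-false-image (image τ′ T) w) ⟩
  r (image (punchIn w) (image τ′ T))  ≡⟨ cong r (image-∘ (punchIn w) τ′ T) ⟨
  r (image (punchIn w ∘ τ′) T)        ≡⟨ cong r (image-cong (λ j → punchIn-punchOut (avoid j)) T) ⟩
  r (image τ T)                       ≡⟨ res T ⟩
  u T                                 ∎
  where
  open ≡-Reasoning
  τ′ : Fin k → Fin n
  τ′ j = punchOut (avoid j)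

restriction-onto⇒iso : ∀ {n k} {r : Rank n} {u : Rank k} (τ : Fin k → Fin n) → Injective _≡_ _≡_ τ →
                       (∀ w → ∃[ j ] (τ j ≡ w)) → Restriction r τ u → Isomorphic r u
restriction-onto⇒iso {r = r} τ τ-injective onto res =
  σ , λ S → trans (sym (res (image (Inverse.to σ) S))) (cong r (image-from∘to σ S))
  where
  σ : Fin _ ↔ Fin _
  σ = mk↔ₛ′ (proj₁ ∘ onto) τ (λ j → τ-injective (proj₂ (onto (τ j)))) (proj₂ ∘ onto)

-- Delete elements outside the image of τ until τ is onto, hence an isomorphism.
restriction⇒minor : ∀ {n k} {r : Rank n} {u : Rank k} (τ : Fin k → Fin n) → Injective _≡_ _≡_ τ →
                    Restriction r τ u → HasMinor r u
restriction⇒minor {n} τ τ-injective res with all? (λ w → any? (λ j → τ j ≟ w))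
... | yes onto = iso (restriction-onto⇒iso τ τ-injective onto res)
... | no ¬onto with ¬∀⟶∃¬ n _ (λ w → any? (λ j → τ j ≟ w)) ¬onto
restriction⇒minor {suc n} {r = r} τ τ-injective res | no _ | w , w∉τ =
  del w (restriction⇒minor (λ j → punchOut (avoid j))
          (λ eq → τ-injective (punchOut-injective (avoid _) (avoid _) eq))
          (restriction-delete {r = r} τ w avoid res))
  where
  avoid : ∀ j → w ≢ τ j
  avoid j w≡τj = w∉τ (j , sym w≡τj)

module _ {n} {r : Rank n} (mat : IsMatroid r) where
  open IsMatroid mat

  rank-pair≡2⇒≢ : ∀ {x y} → r (⁅ x ⁆ ∪ ⁅ y ⁆) ≡ 2 → x ≢ y
  rank-pair≡2⇒≢ {x} xy refl = <-irrefl refl (subst (_≤ 1) xy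
    (subst (_≤ 1) (cong r (sym (∪-idem ⁅ x ⁆))) (rank-⁅⁆-≤1 mat x)))

  rank-pair≡2⇒rank-⁅⁆≡1 : ∀ {x y} → r (⁅ x ⁆ ∪ ⁅ y ⁆) ≡ 2 → r ⁅ x ⁆ ≡ 1
  rank-pair≡2⇒rank-⁅⁆≡1 {x} {y} xy with rank-⁅⁆-loop-or-1 mat x
  ... | inj₂ one  = one
  ... | inj₁ loop = ⊥-elim (<-irrefl refl (subst (_≤ 1) xy
    (subst (_≤ 1) (sym (trans (cong r (∪-comm ⁅ x ⁆ ⁅ y ⁆)) (rank-∪-loop mat ⁅ y ⁆ loop))) (rank-⁅⁆-≤1 mat y))))

  triangle⇒U₂,₃-minor : ∀ {x y z} → r (⁅ x ⁆ ∪ ⁅ y ⁆) ≡ 2 → r (⁅ x ⁆ ∪ ⁅ z ⁆) ≡ 2 → r (⁅ y ⁆ ∪ ⁅ z ⁆) ≡ 2 →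
                        r (⁅ x ⁆ ∪ ⁅ y ⁆ ∪ ⁅ z ⁆) ≡ 2 → HasMinor r (U 2 3)
  triangle⇒U₂,₃-minor {x} {y} {z} xy xz yz xyz = restriction⇒minor τ τ-injective restriction
    where
    τ : Fin 3 → Fin n
    τ zero             = x
    τ (suc zero)       = y
    τ (suc (suc zero)) = z
    τ-injective : Injective _≡_ _≡_ τ
    τ-injective {zero}             {zero}             _  = refl
    τ-injective {zero}             {suc zero}         eq = ⊥-elim (rank-pair≡2⇒≢ xy eq)
    τ-injective {zero}             {suc (suc zero)}   eq = ⊥-elim (rank-pair≡2⇒≢ xz eq)
    τ-injective {suc zero}         {zero}             eq = ⊥-elim (rank-pair≡2⇒≢ xy (sym eq))
    τ-injective {suc zero}         {suc zero}         _  = refl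
    τ-injective {suc zero}         {suc (suc zero)}   eq = ⊥-elim (rank-pair≡2⇒≢ yz eq)
    τ-injective {suc (suc zero)}   {zero}             eq = ⊥-elim (rank-pair≡2⇒≢ xz (sym eq))
    τ-injective {suc (suc zero)}   {suc zero}         eq = ⊥-elim (rank-pair≡2⇒≢ yz (sym eq))
    τ-injective {suc (suc zero)}   {suc (suc zero)}   _  = refl
    rank-z : r ⁅ z ⁆ ≡ 1
    rank-z = rank-pair≡2⇒rank-⁅⁆≡1 (trans (cong r (∪-comm ⁅ z ⁆ ⁅ x ⁆)) xz)
    via : ∀ {A B k} → A ≡ B → r B ≡ k → r A ≡ k
    via eq rB = trans (cong r eq) rB
    restriction : Restriction r τ (U 2 3)
    restriction (b₀ ∷ b₁ ∷ b₂ ∷ []) = via (cong (_ ∪_) (cong (_ ∪_) (∪-identityʳ _))) (by-cases b₀ b₁ b₂)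
      where
      ⟦_⟧ : Bool → Fin n → Subset n
      ⟦ b ⟧ w = if b then ⁅ w ⁆ else ⊥
      by-cases : ∀ b₀ b₁ b₂ → r (⟦ b₀ ⟧ x ∪ ⟦ b₁ ⟧ y ∪ ⟦ b₂ ⟧ z) ≡ U 2 3 (b₀ ∷ b₁ ∷ b₂ ∷ [])
      by-cases false false false = via (trans (∪-identityˡ _) (∪-identityˡ _)) r-∅
      by-cases false false true  = via (trans (∪-identityˡ _) (∪-identityˡ _)) rank-z
      by-cases false true  false = via (trans (∪-identityˡ _) (∪-identityʳ _)) (rank-pair≡2⇒rank-⁅⁆≡1 yz)
      by-cases false true  true  = via (∪-identityˡ _) yz
      by-cases true  false false = via (trans (cong (⁅ x ⁆ ∪_) (∪-identityˡ ⊥)) (∪-identityʳ _)) (rank-pair≡2⇒rank-⁅⁆≡1 xy)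
      by-cases true  false true  = via (cong (_ ∪_) (∪-identityˡ _)) xz
      by-cases true  true  false = via (cong (_ ∪_) (∪-identityʳ _)) xy
      by-cases true  true  true  = xyz

-- Closure in U₂,₃-free matroids

LoopOrParallelIn : ∀ {n} → Rank n → Subset n → Fin n → Set
LoopOrParallelIn r S x = IsLoop r x ⊎ ∃[ y ] (y ∈ S × Parallel r x y)

-- The closure of every S consists of S, the loops, and the elements parallel to an element of S.
TrivialClosure : ∀ {n} → Rank n → Set
TrivialClosure {n} r = ∀ S x → x ∉ S → r (S ∪ ⁅ x ⁆) ≡ r S → LoopOrParallelIn r S x

module _ {n} (r : Rank (suc n)) (z : Fin (suc n)) where

  delete-⁅⁆ : ∀ j → delete z r ⁅ j ⁆ ≡ r ⁅ punchIn z j ⁆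
  delete-⁅⁆ j = cong r (insertAt-⁅⁆ z j)

  delete-pair : ∀ i j → delete z r (⁅ i ⁆ ∪ ⁅ j ⁆) ≡ r (⁅ punchIn z i ⁆ ∪ ⁅ punchIn z j ⁆)
  delete-pair i j = cong r (trans (insertAt-∪-⁅⁆ ⁅ i ⁆ z false j) (cong (_∪ _) (insertAt-⁅⁆ z i)))

  contract-⁅⁆ : ∀ j → contract z r ⁅ j ⁆ ≡ r (⁅ z ⁆ ∪ ⁅ punchIn z j ⁆) ∸ r ⁅ z ⁆
  contract-⁅⁆ j = cong (λ S → r S ∸ r ⁅ z ⁆) (trans (insertAt-true ⁅ j ⁆ z) (cong (⁅ z ⁆ ∪_) (insertAt-⁅⁆ z j)))

  contract-pair : ∀ i j → contract z r (⁅ i ⁆ ∪ ⁅ j ⁆) ≡ r (⁅ z ⁆ ∪ ⁅ punchIn z i ⁆ ∪ ⁅ punchIn z j ⁆) ∸ r ⁅ z ⁆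
  contract-pair i j = cong (λ S → r S ∸ r ⁅ z ⁆) (trans (insertAt-true (⁅ i ⁆ ∪ ⁅ j ⁆) z)
    (cong (⁅ z ⁆ ∪_) (trans (insertAt-∪-⁅⁆ ⁅ i ⁆ z false j) (cong (_∪ _) (insertAt-⁅⁆ z i)))))

  parallel-delete : ∀ {i j} → Parallel (delete z r) i j → Parallel r (punchIn z i) (punchIn z j)
  parallel-delete {i} {j} (i≢j , pos , ij , jij) =
    i≢j ∘ punchIn-injective z i j ,
    subst (0 <_) (delete-⁅⁆ i) pos ,
    trans (sym (delete-⁅⁆ i)) (trans ij (delete-⁅⁆ j)) ,
    trans (sym (delete-⁅⁆ j)) (trans jij (delete-pair i j))

  loopOrParallel-delete : ∀ {S′ x′} → LoopOrParallelIn (delete z r) S′ x′ →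
                          LoopOrParallelIn r (insertAt S′ z true) (punchIn z x′)
  loopOrParallel-delete {x′ = x′} (inj₁ loop)                = inj₁ (trans (sym (delete-⁅⁆ x′)) loop)
  loopOrParallel-delete           (inj₂ (y′ , y′∈S′ , x∥y)) =
    inj₂ (punchIn z y′ , punchIn-∈-insertAt z true y′∈S′ , parallel-delete x∥y)

  rank-stable-contract : ∀ S′ x′ → r (insertAt S′ z true ∪ ⁅ punchIn z x′ ⁆) ≡ r (insertAt S′ z true) →
                         contract z r (S′ ∪ ⁅ x′ ⁆) ≡ contract z r S′
  rank-stable-contract S′ x′ stable = cong (_∸ r ⁅ z ⁆) (trans (cong r (insertAt-∪-⁅⁆ S′ z true x′)) stable)

module _ {n} {r : Rank (suc n)} (mat : IsMatroid r) {z : Fin (suc n)} where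

  rank-stable-delete : IsLoop r z → ∀ S′ x′ →
                       r (insertAt S′ z true ∪ ⁅ punchIn z x′ ⁆) ≡ r (insertAt S′ z true) →
                       delete z r (S′ ∪ ⁅ x′ ⁆) ≡ delete z r S′
  rank-stable-delete loop S′ x′ stable = begin
    r (insertAt (S′ ∪ ⁅ x′ ⁆) z false) ≡⟨ cong r (insertAt-∪-⁅⁆ S′ z false x′) ⟩
    r (S₀ ∪ ⁅ x ⁆)                      ≡⟨ rank-∪-loop mat (S₀ ∪ ⁅ x ⁆) loop ⟨
    r ((S₀ ∪ ⁅ x ⁆) ∪ ⁅ z ⁆)            ≡⟨ cong r (trans (∪-comm _ ⁅ z ⁆) (sym (∪-assoc ⁅ z ⁆ S₀ ⁅ x ⁆))) ⟩
    r ((⁅ z ⁆ ∪ S₀) ∪ ⁅ x ⁆)            ≡⟨ cong (λ S → r (S ∪ ⁅ x ⁆)) (insertAt-true S′ z) ⟨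
    r (insertAt S′ z true ∪ ⁅ x ⁆)      ≡⟨ stable ⟩
    r (insertAt S′ z true)              ≡⟨ cong r (trans (insertAt-true S′ z) (∪-comm ⁅ z ⁆ S₀)) ⟩
    r (S₀ ∪ ⁅ z ⁆)                      ≡⟨ rank-∪-loop mat S₀ loop ⟩
    r S₀                                ∎
    where
    open ≡-Reasoning
    S₀ : Subset (suc n)
    S₀ = insertAt S′ z false
    x : Fin (suc n)
    x = punchIn z x′

  parallel-contract⇒ranks : r ⁅ z ⁆ ≡ 1 → ∀ {x′ y′} → Parallel (contract z r) x′ y′ →
                            r (⁅ z ⁆ ∪ ⁅ punchIn z x′ ⁆) ≡ 2 × r (⁅ z ⁆ ∪ ⁅ punchIn z y′ ⁆) ≡ 2 ×
                            r (⁅ z ⁆ ∪ ⁅ punchIn z x′ ⁆ ∪ ⁅ punchIn z y′ ⁆) ≡ 2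
  parallel-contract⇒ranks rank-z {x′} {y′} (_ , pos , x′y′ , y′x′y′) = rank-zx , rank-zy , rank-zxy
    where
    x y : Fin (suc n)
    x = punchIn z x′
    y = punchIn z y′
    z≤ : ∀ S → r ⁅ z ⁆ ≤ r (⁅ z ⁆ ∪ S)
    z≤ S = rank-∪ˡ mat ⁅ z ⁆ S
    rank-zx : r (⁅ z ⁆ ∪ ⁅ x ⁆) ≡ 2
    rank-zx = ≤-antisym (rank-pair-≤2 mat z x)
      (m∸n≢0⇒n<m λ eq → <-irrefl (sym (trans (contract-⁅⁆ r z x′) (trans (cong (r (⁅ z ⁆ ∪ ⁅ x ⁆) ∸_) rank-z) eq)))
                                  pos)
    rank-zy : r (⁅ z ⁆ ∪ ⁅ y ⁆) ≡ 2
    rank-zy = trans (sym (∸-cancelʳ-≡ (z≤ _) (z≤ _)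
      (trans (sym (contract-⁅⁆ r z x′)) (trans x′y′ (contract-⁅⁆ r z y′))))) rank-zx
    rank-zxy : r (⁅ z ⁆ ∪ ⁅ x ⁆ ∪ ⁅ y ⁆) ≡ 2
    rank-zxy = trans (sym (∸-cancelʳ-≡ (z≤ _) (z≤ _)
      (trans (sym (contract-⁅⁆ r z y′)) (trans y′x′y′ (contract-pair r z x′ y′))))) rank-zy

  loopOrParallel-contract : ¬ HasMinor r (U 2 3) → r ⁅ z ⁆ ≡ 1 → ∀ {S′ x′} → r ⁅ punchIn z x′ ⁆ ≡ 1 →
                            LoopOrParallelIn (contract z r) S′ x′ →
                            LoopOrParallelIn r (insertAt S′ z true) (punchIn z x′)
  loopOrParallel-contract noMinor rank-z {S′} {x′} rank-x (inj₁ loop) =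
    inj₂ (z , ∈-insertAt-true S′ z , rank-1⇒parallel mat (punchInᵢ≢i z x′) rank-x rank-z rank-xz)
    where
    rank-zx≤1 : r (⁅ z ⁆ ∪ ⁅ punchIn z x′ ⁆) ≤ 1
    rank-zx≤1 = subst (r (⁅ z ⁆ ∪ ⁅ punchIn z x′ ⁆) ≤_) rank-z (m∸n≡0⇒m≤n (trans (sym (contract-⁅⁆ r z x′)) loop))
    rank-xz : r (⁅ punchIn z x′ ⁆ ∪ ⁅ z ⁆) ≡ 1
    rank-xz = trans (cong r (∪-comm _ ⁅ z ⁆))
      (≤-antisym rank-zx≤1 (subst (_≤ r (⁅ z ⁆ ∪ ⁅ punchIn z x′ ⁆)) rank-z (rank-∪ˡ mat ⁅ z ⁆ _)))
  loopOrParallel-contract noMinor rank-z {S′} {x′} rank-x (inj₂ (y′ , y′∈S′ , x′∥y′))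
    with parallel-contract⇒ranks rank-z x′∥y′ | rank-pair-1-or-2 mat (punchIn z y′) rank-x
  ... | rank-zx , rank-zy , rank-zxy | inj₂ rank-xy =
    ⊥-elim (noMinor (triangle⇒U₂,₃-minor mat rank-zx rank-zy rank-xy rank-zxy))
  ... | _ , rank-zy , _ | inj₁ rank-xy =
    inj₂ (punchIn z y′ , punchIn-∈-insertAt z true y′∈S′ ,
          rank-1⇒parallel mat (proj₁ x′∥y′ ∘ punchIn-injective z x′ y′) rank-x
            (rank-pair≡2⇒rank-⁅⁆≡1 mat (trans (cong r (∪-comm _ ⁅ z ⁆)) rank-zy)) rank-xy)

trivialClosure-step : ∀ {n} {r : Rank (suc n)} →
               (∀ {r′ : Rank n} → IsMatroid r′ → ¬ HasMinor r′ (U 2 3) → TrivialClosure r′) →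
               IsMatroid r → ¬ HasMinor r (U 2 3) → ∀ z S′ x′ → x′ ∉ S′ → r ⁅ punchIn z x′ ⁆ ≡ 1 →
               r (insertAt S′ z true ∪ ⁅ punchIn z x′ ⁆) ≡ r (insertAt S′ z true) →
               LoopOrParallelIn r (insertAt S′ z true) (punchIn z x′)
trivialClosure-step {r = r} trivialClosure mat noMinor z S′ x′ x′∉S′ rank-x stable with rank-⁅⁆-loop-or-1 mat z
... | inj₁ loop   = loopOrParallel-delete r z
  (trivialClosure (delete-isMatroid z mat) (noMinor ∘ del z) S′ x′ x′∉S′
    (rank-stable-delete mat loop S′ x′ stable))
... | inj₂ rank-z = loopOrParallel-contract mat noMinor rank-z rank-x
  (trivialClosure (contract-isMatroid z mat) (noMinor ∘ con z) S′ x′ x′∉S′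
    (rank-stable-contract r z S′ x′ stable))

¬U₂,₃-minor⇒trivialClosure : ∀ {n} {r : Rank n} → IsMatroid r → ¬ HasMinor r (U 2 3) → TrivialClosure r
¬U₂,₃-minor⇒trivialClosure {suc n} {r} mat noMinor S x x∉S stable with rank-⁅⁆-loop-or-1 mat x | nonempty? S
... | inj₁ loop   | _ = inj₁ loop
... | inj₂ rank-x | no S-empty = ⊥-elim (0≢1+n (trans (sym rank-x≡0) rank-x))
  where
  rank-x≡0 : r ⁅ x ⁆ ≡ 0
  rank-x≡0 = trans (cong r (sym (∪-identityˡ ⁅ x ⁆)))
    (trans (cong (λ T → r (T ∪ ⁅ x ⁆)) (sym S≡⊥)) (trans stable (trans (cong r S≡⊥) (IsMatroid.r-∅ mat))))
    where
    S≡⊥ : S ≡ ⊥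
    S≡⊥ = Empty-unique S-empty
... | inj₂ rank-x | yes (z , z∈S) = subst₂ (LoopOrParallelIn r) S′-z≡S x′-z≡x
  (trivialClosure-step (¬U₂,₃-minor⇒trivialClosure {n}) mat noMinor z S′ x′ x′∉S′
    (subst (λ w → r ⁅ w ⁆ ≡ 1) (sym x′-z≡x) rank-x)
    (subst₂ (λ T w → r (T ∪ ⁅ w ⁆) ≡ r T) (sym S′-z≡S) (sym x′-z≡x) stable))
  where
  z≢x : z ≢ x
  z≢x z≡x = x∉S (subst (_∈ S) z≡x z∈S)
  S′ : Subset n
  S′ = removeAt S z
  x′ : Fin n
  x′ = punchOut z≢x
  S′-z≡S : insertAt S′ z true ≡ S
  S′-z≡S = insertAt-removeAt-∈ z∈S
  x′-z≡x : punchIn z x′ ≡ x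
  x′-z≡x = punchIn-punchOut z≢x
  x′∉S′ : x′ ∉ S′
  x′∉S′ x′∈S′ = x∉S (subst₂ _∈_ x′-z≡x S′-z≡S (punchIn-∈-insertAt z true x′∈S′))

-- Free simplifications

parallel-sym : ∀ {n} {r : Rank n} {x y} → Parallel r x y → Parallel r y x
parallel-sym {r = r} {x} {y} (x≢y , pos , xy , yxy) =
  x≢y ∘ sym , subst (0 <_) xy pos , sym xy , trans xy (trans yxy (cong r (∪-comm ⁅ x ⁆ ⁅ y ⁆)))

InTrivialClosure : ∀ {n} → Rank n → Subset n → Fin n → Set
InTrivialClosure r B x = x ∈ B ⊎ LoopOrParallelIn r B x

inTrivialClosure-mono : ∀ {n} {r : Rank n} {B B′ x} → B ⊆ B′ → InTrivialClosure r B x → InTrivialClosure r B′ x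
inTrivialClosure-mono B⊆B′ (inj₁ x∈B)                      = inj₁ (B⊆B′ x∈B)
inTrivialClosure-mono B⊆B′ (inj₂ (inj₁ loop))              = inj₂ (inj₁ loop)
inTrivialClosure-mono B⊆B′ (inj₂ (inj₂ (y , y∈B , x∥y)))   = inj₂ (inj₂ (y , B⊆B′ y∈B , x∥y))

parallel? : ∀ {n} (r : Rank n) x y → Dec (Parallel r x y)
parallel? r x y =
  ¬? (x ≟ y) ×-dec 0 ℕ.<? r ⁅ x ⁆ ×-dec r ⁅ x ⁆ ℕ.≟ r ⁅ y ⁆ ×-dec r ⁅ y ⁆ ℕ.≟ r (⁅ x ⁆ ∪ ⁅ y ⁆)

module _ {n} {r : Rank n} (mat : IsMatroid r) where
  open IsMatroid mat

  -- Submodularity with the pair {x, y}, which meets A in y and has the rank of y.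
  rank-∪-parallel : ∀ A {x y} → y ∈ A → Parallel r x y → r (A ∪ ⁅ x ⁆) ≡ r A
  rank-∪-parallel A {x} {y} y∈A (_ , _ , _ , y≡xy) = ≤-antisym
    (+-cancelʳ-≤ (r P) _ _ (≤-trans (+-monoʳ-≤ (r (A ∪ ⁅ x ⁆)) P≤A∩P)
      (subst (λ T → r T + r (A ∩ P) ≤ r A + r P) A∪P≡A∪x (r-submod A P))))
    (rank-∪ˡ mat A ⁅ x ⁆)
    where
    P : Subset n
    P = ⁅ x ⁆ ∪ ⁅ y ⁆
    A∪P≡A∪x : A ∪ P ≡ A ∪ ⁅ x ⁆
    A∪P≡A∪x = trans (cong (A ∪_) (∪-comm ⁅ x ⁆ ⁅ y ⁆))
      (trans (sym (∪-assoc A ⁅ y ⁆ ⁅ x ⁆)) (cong (_∪ ⁅ x ⁆) (∪-absorbs-∈ y∈A)))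
    P≤A∩P : r P ≤ r (A ∩ P)
    P≤A∩P = subst (_≤ r (A ∩ P)) y≡xy (r-mono λ z∈y → x∈p∩q⁺
      (subst (_∈ A) (sym (x∈⁅y⁆⇒x≡y y z∈y)) y∈A , q⊆p∪q ⁅ x ⁆ ⁅ y ⁆ z∈y))

  parallel-trans : ∀ {x y w} → Parallel r x y → Parallel r y w → x ≢ w → Parallel r x w
  parallel-trans {x} {y} {w} x∥y@(_ , pos , xy , _) y∥w@(_ , _ , yw , _) x≢w = x≢w , pos , trans xy yw , sym rank-xw
    where
    rank-y-x-w : r (⁅ y ⁆ ∪ ⁅ x ⁆ ∪ ⁅ w ⁆) ≡ r ⁅ y ⁆
    rank-y-x-w = begin
      r (⁅ y ⁆ ∪ ⁅ x ⁆ ∪ ⁅ w ⁆)   ≡⟨ cong r (∪-assoc ⁅ y ⁆ ⁅ x ⁆ ⁅ w ⁆) ⟨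
      r ((⁅ y ⁆ ∪ ⁅ x ⁆) ∪ ⁅ w ⁆) ≡⟨ rank-∪-parallel (⁅ y ⁆ ∪ ⁅ x ⁆) (p⊆p∪q ⁅ x ⁆ (x∈⁅x⁆ y))
                                                      (parallel-sym {r = r} y∥w) ⟩
      r (⁅ y ⁆ ∪ ⁅ x ⁆)           ≡⟨ rank-∪-parallel ⁅ y ⁆ (x∈⁅x⁆ y) x∥y ⟩
      r ⁅ y ⁆                      ∎
      where open ≡-Reasoning
    rank-xw : r (⁅ x ⁆ ∪ ⁅ w ⁆) ≡ r ⁅ w ⁆
    rank-xw = ≤-antisym
      (subst (r (⁅ x ⁆ ∪ ⁅ w ⁆) ≤_) (trans rank-y-x-w yw) (rank-∪ʳ mat ⁅ y ⁆ (⁅ x ⁆ ∪ ⁅ w ⁆)))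
      (subst (_≤ r (⁅ x ⁆ ∪ ⁅ w ⁆)) (trans xy yw) (rank-∪ˡ mat ⁅ x ⁆ ⁅ w ⁆))

  rank-∪-inTrivialClosure-⁅⁆ : ∀ B {x} → InTrivialClosure r B x → r (B ∪ ⁅ x ⁆) ≡ r B
  rank-∪-inTrivialClosure-⁅⁆ B (inj₁ x∈B)                    = cong r (∪-absorbs-∈ x∈B)
  rank-∪-inTrivialClosure-⁅⁆ B (inj₂ (inj₁ loop))            = rank-∪-loop mat B loop
  rank-∪-inTrivialClosure-⁅⁆ B (inj₂ (inj₂ (y , y∈B , x∥y))) = rank-∪-parallel B y∈B x∥y

  rank-∪-image-inTrivialClosure : ∀ B {k} (f : Fin k → Fin n) S →
                                  (∀ {y} → y ∈ S → InTrivialClosure r B (f y)) → r (B ∪ image f S) ≡ r B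
  rank-∪-image-inTrivialClosure B f []      _ = cong r (∪-identityʳ B)
  rank-∪-image-inTrivialClosure B f (b ∷ S) h = begin
    r (B ∪ X ∪ I)    ≡⟨ cong r (trans (cong (B ∪_) (∪-comm X I)) (sym (∪-assoc B I X))) ⟩
    r ((B ∪ I) ∪ X)  ≡⟨ adding-X b refl ⟩
    r (B ∪ I)        ≡⟨ rank-∪-image-inTrivialClosure B (f ∘ suc) S (h ∘ there) ⟩
    r B              ∎
    where
    open ≡-Reasoning
    X I : Subset n
    X = if b then ⁅ f zero ⁆ else ⊥
    I = image (f ∘ suc) S
    adding-X : ∀ b′ → b′ ≡ b → r ((B ∪ I) ∪ (if b′ then ⁅ f zero ⁆ else ⊥)) ≡ r (B ∪ I)
    adding-X true  refl = rank-∪-inTrivialClosure-⁅⁆ (B ∪ I) (inTrivialClosure-mono {r = r} (p⊆p∪q I) (h here))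
    adding-X false _    = cong r (∪-identityʳ (B ∪ I))

  rank-∪-inTrivialClosure : ∀ B T → (∀ {x} → x ∈ T → InTrivialClosure r B x) → r (B ∪ T) ≡ r B
  rank-∪-inTrivialClosure B T h =
    trans (cong (λ T → r (B ∪ T)) (sym (image-id T))) (rank-∪-image-inTrivialClosure B id T h)

  rank-image-independent : TrivialClosure r → ∀ {d} (f : Fin d → Fin n) → Injective _≡_ _≡_ f →
                           (∀ j → ¬ IsLoop r (f j)) → (∀ j j′ → ¬ Parallel r (f j) (f j′)) →
                           ∀ J → r (image f J) ≡ ∣ J ∣
  rank-image-independent closure f inj noLoop noParallel [] = r-∅
  rank-image-independent closure f inj noLoop noParallel (b ∷ J) = by-cases b
    where
    open ≡-Reasoning
    X : Subset n
    X = image (f ∘ suc) J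
    rank-X : r X ≡ ∣ J ∣
    rank-X = rank-image-independent closure (f ∘ suc) (suc-injective ∘ inj) (noLoop ∘ suc)
               (λ j j′ → noParallel (suc j) (suc j′)) J
    f₀∉X : f zero ∉ X
    f₀∉X f₀∈X with ∈-image⁻ (f ∘ suc) J f₀∈X
    ... | _ , _ , eq with inj eq
    ... | ()
    rank-changes : r (X ∪ ⁅ f zero ⁆) ≢ r X
    rank-changes eq with closure X (f zero) f₀∉X eq
    ... | inj₁ loop = noLoop zero loop
    ... | inj₂ (y , y∈X , f₀∥y) with ∈-image⁻ (f ∘ suc) J y∈X
    ... | j , _ , refl = noParallel zero (suc j) f₀∥y
    rank-increases : r (X ∪ ⁅ f zero ⁆) ≡ suc (r X)
    rank-increases with m≤n⇒m<n∨m≡n (rank-∪ˡ mat X ⁅ f zero ⁆)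
    ... | inj₁ X<X∪f₀ = ≤-antisym (rank-∪⁅⁆-≤ mat X (f zero)) X<X∪f₀
    ... | inj₂ X≡X∪f₀ = ⊥-elim (rank-changes (sym X≡X∪f₀))
    by-cases : ∀ b → r ((if b then ⁅ f zero ⁆ else ⊥) ∪ X) ≡ ∣ b ∷ J ∣
    by-cases false = trans (cong r (∪-identityˡ X)) rank-X
    by-cases true  = begin
      r (⁅ f zero ⁆ ∪ X)  ≡⟨ cong r (∪-comm ⁅ f zero ⁆ X) ⟩
      r (X ∪ ⁅ f zero ⁆)  ≡⟨ rank-increases ⟩
      suc (r X)           ≡⟨ cong suc rank-X ⟩
      suc ∣ J ∣           ∎

  FirstOfClass : Fin n → Set
  FirstOfClass x = ¬ IsLoop r x × ¬ (∃[ y ] (y Fin.< x × Parallel r x y))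

  firstOfClass? : ∀ x → Dec (FirstOfClass x)
  firstOfClass? x = ¬? (r ⁅ x ⁆ ℕ.≟ 0) ×-dec ¬? (any? (λ y → (y FinP.<? x) ×-dec parallel? r x y))

  representatives : List (Fin n)
  representatives = filter firstOfClass? (allFin n)

  representative : Fin (length representatives) → Fin n
  representative = List.lookup representatives

  representative-first : ∀ j → FirstOfClass (representative j)
  representative-first j = proj₂ (∈-filter⁻ firstOfClass? {xs = allFin n} (∈-lookup j))

  representative-injective : Injective _≡_ _≡_ representative
  representative-injective = lookup-injective (UniqueP.filter⁺ firstOfClass? (UniqueP.allFin⁺ n)) _ _

  representative-¬parallel : ∀ j j′ → ¬ Parallel r (representative j) (representative j′)
  representative-¬parallel j j′ x∥y with FinP.<-cmp (representative j) (representative j′)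
  ... | tri< x<y _ _ = proj₂ (representative-first j′) (representative j , x<y , parallel-sym {r = r} x∥y)
  ... | tri≈ _ x≡y _ = proj₁ x∥y x≡y
  ... | tri> _ _ y<x = proj₂ (representative-first j) (representative j′ , y<x , x∥y)

  representative-covers : ∀ x → ¬ IsLoop r x → ∃[ j ] (representative j ≡ x ⊎ Parallel r x (representative j))
  representative-covers = WF.All.wfRec FinInd.<-wellFounded 0ℓ _ step
    where
    Covered : Fin n → Set
    Covered x = ¬ IsLoop r x → ∃[ j ] (representative j ≡ x ⊎ Parallel r x (representative j))
    step : ∀ x → (∀ {y} → y Fin.< x → Covered y) → Covered x
    step x rec ¬loop with firstOfClass? x
    ... | yes first = Any.index x∈ , inj₁ (sym (lookup-index x∈))
      where x∈ = ∈-filter⁺ firstOfClass? (∈-allFin x) first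
    ... | no ¬first with any? (λ y → (y FinP.<? x) ×-dec parallel? r x y)
    ...   | no none = ⊥-elim (¬first (¬loop , none))
    ...   | yes (y , y<x , x∥y@(_ , pos , xy , _)) with rec y<x (λ loop → <-irrefl (sym loop) (subst (0 <_) xy pos))
    ...     | j , inj₁ rep≡y  = j , inj₂ (subst (Parallel r x) (sym rep≡y) x∥y)
    ...     | j , inj₂ y∥rep  = j , inj₂ (parallel-trans x∥y y∥rep
                                  (λ x≡rep → ¬first (subst FirstOfClass (sym x≡rep) (representative-first j))))

record FreeSimplification {n} (r : Rank n) : Set where
  field
    size                : ℕ
    keep                : Fin size → Fin n
    isSimplificationMap : IsSimplificationMap r keep
    rank-image          : ∀ J → r (image keep J) ≡ ∣ J ∣

trivialClosure⇒freeSimplification : ∀ {n} {r : Rank n} → IsMatroid r → TrivialClosure r → FreeSimplification r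
trivialClosure⇒freeSimplification mat closure = record
  { size                = length (representatives mat)
  ; keep                = representative mat
  ; isSimplificationMap = representative-injective mat , proj₁ ∘ representative-first mat ,
                          representative-¬parallel mat , representative-covers mat
  ; rank-image          = rank-image-independent mat closure (representative mat) (representative-injective mat)
                            (proj₁ ∘ representative-first mat) (representative-¬parallel mat)
  }

allLoops⇒freeSimplification : ∀ {n} {r : Rank n} → IsMatroid r → AllLoops r → FreeSimplification r
allLoops⇒freeSimplification mat allLoops = record
  { size                = 0
  ; keep                = λ ()
  ; isSimplificationMap = (λ { {()} }) , (λ ()) , (λ ()) , (λ x ¬loop → ⊥-elim (¬loop (allLoops x)))
  ; rank-image          = λ { [] → IsMatroid.r-∅ mat }
  }

∣p∣⊓n≡∣p∣ : ∀ {d} (J : Subset d) → ∣ J ∣ ⊓ d ≡ ∣ J ∣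
∣p∣⊓n≡∣p∣ J = m≤n⇒m⊓n≡m (∣p∣≤n J)

freeSimplification⇒simplificationIsFree : ∀ {n} {r : Rank n} → FreeSimplification r → SimplificationIsFree r
freeSimplification⇒simplificationIsFree {r = r} free = size , keep , isSimplificationMap , size , ↔-id _ ,
  λ J → trans (cong (λ T → ∣ T ∣ ⊓ size) (image-id J)) (trans (∣p∣⊓n≡∣p∣ J) (sym (rank-image J)))
  where open FreeSimplification free

simplificationIsFree⇒freeSimplification : ∀ {n} {r : Rank n} → SimplificationIsFree r → FreeSimplification r
simplificationIsFree⇒freeSimplification {r = r}
  (k , f , (f-injective , noLoop , noParallel , covers) , d , σ , r≅U) = record
  { size                = d
  ; keep                = f ∘ from
  ; isSimplificationMap = from-injective ∘ f-injective , noLoop ∘ from ,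
                          (λ j j′ → noParallel (from j) (from j′)) ,
                          λ x ¬loop → let (j , eq) = covers x ¬loop in
                            to j , subst (λ i → f i ≡ x ⊎ Parallel r x (f i)) (sym (strictlyInverseʳ j)) eq
  ; rank-image          = λ J → begin
      r (image (f ∘ from) J)          ≡⟨ cong r (image-∘ f from J) ⟩
      r (image f (image from J))      ≡⟨ r≅U (image from J) ⟨
      ∣ image to (image from J) ∣ ⊓ d ≡⟨ cong (λ T → ∣ T ∣ ⊓ d) (image-to∘from σ J) ⟩
      ∣ J ∣ ⊓ d                       ≡⟨ ∣p∣⊓n≡∣p∣ J ⟩
      ∣ J ∣                           ∎
  }
  where
  open ≡-Reasoning
  open Inverse σ using (to; from; strictlyInverseˡ; strictlyInverseʳ)
  from-injective : Injective _≡_ _≡_ from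
  from-injective {i} {j} eq = trans (sym (strictlyInverseˡ i)) (trans (cong to eq) (strictlyInverseˡ j))

-- Matroids with free simplification are representable over every group

allVectors : ∀ m d → List (Vec (Fin m) d)
allVectors m zero    = [] ∷ []
allVectors m (suc d) = cartesianProductWith _∷_ (allFin m) (allVectors m d)

∈-allVectors : ∀ {m d} (a : Vec (Fin m) d) → a ∈ₗ allVectors m d
∈-allVectors []      = here refl
∈-allVectors (x ∷ a) = ∈-cartesianProductWith⁺ _∷_ (∈-allFin x) (∈-allVectors a)

allVectors-unique : ∀ m d → Unique (allVectors m d)
allVectors-unique m zero    = [] ∷ []
allVectors-unique m (suc d) =
  UniqueP.cartesianProductWith⁺ _∷_ VecP.∷-injective (UniqueP.allFin⁺ m) (allVectors-unique m d)

length-allVectors : ∀ m d → length (allVectors m d) ≡ m ^ d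
length-allVectors m zero    = refl
length-allVectors m (suc d) = trans (length-cartesianProductWith _∷_ (allFin m) (allVectors m d))
  (cong₂ _*_ (length-tabulate {n = m} id) (length-allVectors m d))

select : ∀ {A : Set} {d} (J : Subset d) → Vec A d → Vec A ∣ J ∣
select []          []      = []
select (true ∷ J)  (x ∷ a) = x ∷ select J a
select (false ∷ J) (x ∷ a) = select J a

spread : ∀ {A : Set} {d} (J : Subset d) → A → Vec A ∣ J ∣ → Vec A d
spread []          e []      = []
spread (true ∷ J)  e (x ∷ b) = x ∷ spread J e b
spread (false ∷ J) e b       = e ∷ spread J e b

select-spread : ∀ {A : Set} {d} (J : Subset d) (e : A) b → select J (spread J e b) ≡ b
select-spread []          e []      = refl
select-spread (true ∷ J)  e (x ∷ b) = cong (x ∷_) (select-spread J e b)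
select-spread (false ∷ J) e b       = select-spread J e b

module _ {m : ℕ} where

  proj≡⇒select≡ : ∀ {d} (J : Subset d) {a a′ : Vec (Fin m) d} → proj J a ≡ proj J a′ → select J a ≡ select J a′
  proj≡⇒select≡ []          {[]}    {[]}    _  = refl
  proj≡⇒select≡ (true ∷ J)  {_ ∷ _} {_ ∷ _} eq =
    cong₂ _∷_ (just-injective (VecP.∷-injectiveˡ eq)) (proj≡⇒select≡ J (VecP.∷-injectiveʳ eq))
  proj≡⇒select≡ (false ∷ J) {_ ∷ _} {_ ∷ _} eq = proj≡⇒select≡ J (VecP.∷-injectiveʳ eq)

  select≡⇒proj≡ : ∀ {d} (J : Subset d) {a a′ : Vec (Fin m) d} → select J a ≡ select J a′ → proj J a ≡ proj J a′
  select≡⇒proj≡ []          {[]}    {[]}    _  = refl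
  select≡⇒proj≡ (true ∷ J)  {_ ∷ _} {_ ∷ _} eq =
    cong₂ _∷_ (cong just (VecP.∷-injectiveˡ eq)) (select≡⇒proj≡ J (VecP.∷-injectiveʳ eq))
  select≡⇒proj≡ (false ∷ J) {_ ∷ _} {_ ∷ _} eq = cong (nothing ∷_) (select≡⇒proj≡ J eq)

  -- The projection π_J has the same fibres as the coordinate selection Γ^d → Γ^J, which is onto.
  card-proj-allVectors : ∀ {d} (J : Subset d) (α : Fin m) → card _≟ᵖ_ (map (proj J) (allVectors m d)) ≡ m ^ ∣ J ∣
  card-proj-allVectors {d} J α = begin
    card _≟ᵖ_ (map (proj J) (allVectors m d))  ≡⟨ card-map-sameKernel _≟ᵖ_ _≟ᵛ_
                                                   (proj J) (select J) (replicate d α) (allVectors m d)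
                                                   (λ _ _ → proj≡⇒select≡ J) (λ _ _ → select≡⇒proj≡ J) ⟩
    card _≟ᵛ_ (map (select J) (allVectors m d)) ≡⟨ card-≡-inverse _≟ᵛ_ _≟ᵛ_ id id (λ _ → ∈-allVectors _) select-onto
                                                   (λ _ → refl) (λ _ → refl) ⟩
    card _≟ᵛ_ (allVectors m ∣ J ∣)             ≡⟨ card-unique _≟ᵛ_ (allVectors-unique m ∣ J ∣) ⟩
    length (allVectors m ∣ J ∣)                 ≡⟨ length-allVectors m ∣ J ∣ ⟩
    m ^ ∣ J ∣                                   ∎
    where
    open ≡-Reasoning
    _≟ᵛ_ : ∀ {k} → DecidableEquality (Vec (Fin m) k)
    _≟ᵛ_ = VecP.≡-dec _≟_
    select-onto : MapsInto id (allVectors m ∣ J ∣) (map (select J) (allVectors m d))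
    select-onto {b} _ = subst (_∈ₗ map (select J) (allVectors m d)) (select-spread J α b)
                          (∈-map⁺ (select J) (∈-allVectors (spread J α b)))

lookup-ext : ∀ {A : Set} {n} {u v : Vec A n} → (∀ i → lookup u i ≡ lookup v i) → u ≡ v
lookup-ext {u = u} {v} eq = trans (sym (VecP.tabulate∘lookup u)) (trans (VecP.tabulate-cong eq) (VecP.tabulate∘lookup v))

module _ {n} {r : Rank n} (mat : IsMatroid r) (free : FreeSimplification r) where
  open FreeSimplification free

  InClass : Fin n → Fin size → Set
  InClass x j = keep j ≡ x ⊎ Parallel r x (keep j)

  classOf : Fin n → Maybe (Fin size)
  classOf x with any? (λ j → (keep j ≟ x) ⊎-dec parallel? r x (keep j))
  ... | yes (j , _) = just j
  ... | no _        = nothing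

  classOf-spec : ∀ x → (∃[ j ] (classOf x ≡ just j × InClass x j)) ⊎ (classOf x ≡ nothing × IsLoop r x)
  classOf-spec x with any? (λ j → (keep j ≟ x) ⊎-dec parallel? r x (keep j))
  ... | yes (j , inClass) = inj₁ (j , refl , inClass)
  ... | no ¬inClass with r ⁅ x ⁆ ℕ.≟ 0
  ...   | yes loop = inj₂ (refl , loop)
  ...   | no ¬loop = ⊥-elim (¬inClass (proj₂ (proj₂ (proj₂ isSimplificationMap)) x ¬loop))

  meets? : ∀ S j → Dec (∃[ x ] (x ∈ S × classOf x ≡ just j))
  meets? S j = any? (λ x → (x ∈? S) ×-dec MaybeP.≡-dec _≟_ (classOf x) (just j))

  classes : Subset n → Subset size
  classes S = subsetOf (meets? S)

  ∈-classes⁺ : ∀ {S x j} → x ∈ S → classOf x ≡ just j → j ∈ classes S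
  ∈-classes⁺ {S} x∈S cx = ∈-subsetOf⁺ (meets? S) (_ , x∈S , cx)

  ∈-classes⁻ : ∀ {S j} → j ∈ classes S → ∃[ x ] (x ∈ S × classOf x ≡ just j)
  ∈-classes⁻ {S} = ∈-subsetOf⁻ (meets? S)

  -- S and the kept elements of its classes have the same trivial closure.
  rank-classes : ∀ S → r S ≡ ∣ classes S ∣
  rank-classes S = begin
    r S        ≡⟨ rank-∪-inTrivialClosure mat S R R-in ⟨
    r (S ∪ R)  ≡⟨ cong r (∪-comm S R) ⟩
    r (R ∪ S)  ≡⟨ rank-∪-inTrivialClosure mat R S S-in ⟩
    r R        ≡⟨ rank-image (classes S) ⟩
    ∣ classes S ∣ ∎
    where
    open ≡-Reasoning
    R : Subset n
    R = image keep (classes S)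
    R-in : ∀ {y} → y ∈ R → InTrivialClosure r S y
    R-in y∈R with ∈-image⁻ keep (classes S) y∈R
    ... | j , j∈ , refl with ∈-classes⁻ j∈
    ... | x , x∈S , cx with classOf-spec x
    ...   | inj₂ (c-nothing , _) with () ← trans (sym c-nothing) cx
    ...   | inj₁ (j′ , c-just , inClass) with refl ← just-injective (trans (sym c-just) cx) =
      [ (λ keep≡x → inj₁ (subst (_∈ S) (sym keep≡x) x∈S)) ,
        (λ x∥keep → inj₂ (inj₂ (x , x∈S , parallel-sym {r = r} x∥keep))) ] inClass
    S-in : ∀ {x} → x ∈ S → InTrivialClosure r R x
    S-in {x} x∈S with classOf-spec x
    ... | inj₂ (_ , loop) = inj₂ (inj₁ loop)
    ... | inj₁ (j , cx , inClass) =
      [ (λ keep≡x → inj₁ (subst (_∈ R) keep≡x keep-j∈R)) ,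
        (λ x∥keep → inj₂ (inj₂ (keep j , keep-j∈R , x∥keep))) ] inClass
      where
      keep-j∈R : keep j ∈ R
      keep-j∈R = ∈-image⁺ keep (∈-classes⁺ x∈S cx)

  module _ {m} (Γ : FinGroup m) where
    open FinGroup Γ
    open IsGroup isGroup using (identityˡ; inverseˡ)
    open GroupProperties (asGroup Γ) using (ε⁻¹≈ε)
    open Pointwise Γ

    value : Vec (Fin m) size → Maybe (Fin size) → Fin m
    value a nothing  = ε
    value a (just j) = lookup a j

    φ : Vec (Fin m) size → Vec (Fin m) n
    φ a = tabulate (value a ∘ classOf)

    lookup-φ : ∀ a x → lookup (φ a) x ≡ value a (classOf x)
    lookup-φ a x = VecP.lookup∘tabulate (value a ∘ classOf) x

    φ-ε : φ εᵛ ≡ εᵛ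
    φ-ε = lookup-ext λ x → trans (lookup-φ εᵛ x) (trans (value-ε (classOf x)) (sym (lookup-εᵛ x)))
      where
      value-ε : ∀ c → value εᵛ c ≡ ε
      value-ε nothing  = refl
      value-ε (just j) = lookup-εᵛ j

    φ-∙ : ∀ a b → φ a ∙ᵛ φ b ≡ φ (a ∙ᵛ b)
    φ-∙ a b = lookup-ext λ x → trans (lookup-∙ᵛ (φ a) (φ b) x)
      (trans (cong₂ _∙_ (lookup-φ a x) (lookup-φ b x)) (trans (value-∙ (classOf x)) (sym (lookup-φ (a ∙ᵛ b) x))))
      where
      value-∙ : ∀ c → value a c ∙ value b c ≡ value (a ∙ᵛ b) c
      value-∙ nothing  = identityˡ ε
      value-∙ (just j) = sym (lookup-∙ᵛ a b j)

    φ-⁻¹ : ∀ a → φ a ⁻¹ᵛ ≡ φ (a ⁻¹ᵛ)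
    φ-⁻¹ a = lookup-ext λ x → trans (lookup-⁻¹ᵛ (φ a) x)
      (trans (cong _⁻¹ (lookup-φ a x)) (trans (value-⁻¹ (classOf x)) (sym (lookup-φ (a ⁻¹ᵛ) x))))
      where
      value-⁻¹ : ∀ c → value a c ⁻¹ ≡ value (a ⁻¹ᵛ) c
      value-⁻¹ nothing  = ε⁻¹≈ε
      value-⁻¹ (just j) = sym (lookup-⁻¹ᵛ a j)

    image-φ : Subgroup Γ n
    image-φ = record
      { elems     = map φ (allVectors m size)
      ; has-ε     = subst (_∈ₗ map φ (allVectors m size)) φ-ε (∈-map⁺ φ (∈-allVectors εᵛ))
      ; closed-∙  = λ u∈ v∈ → closed-∙ (∈-map⁻ φ u∈) (∈-map⁻ φ v∈)
      ; closed-⁻¹ = λ u∈ → closed-⁻¹ (∈-map⁻ φ u∈)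
      }
      where
      closed-∙ : ∀ {u v} → ∃[ a ] (a ∈ₗ allVectors m size × u ≡ φ a) → ∃[ b ] (b ∈ₗ allVectors m size × v ≡ φ b) →
                 u ∙ᵛ v ∈ₗ map φ (allVectors m size)
      closed-∙ (a , _ , refl) (b , _ , refl) =
        subst (_∈ₗ map φ (allVectors m size)) (sym (φ-∙ a b)) (∈-map⁺ φ (∈-allVectors (a ∙ᵛ b)))
      closed-⁻¹ : ∀ {u} → ∃[ a ] (a ∈ₗ allVectors m size × u ≡ φ a) → u ⁻¹ᵛ ∈ₗ map φ (allVectors m size)
      closed-⁻¹ (a , _ , refl) =
        subst (_∈ₗ map φ (allVectors m size)) (sym (φ-⁻¹ a)) (∈-map⁺ φ (∈-allVectors (a ⁻¹ᵛ)))

    proj-φ-≡⇒proj-classes-≡ : ∀ S {a a′} → proj S (φ a) ≡ proj S (φ a′) → proj (classes S) a ≡ proj (classes S) a′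
    proj-φ-≡⇒proj-classes-≡ S {a} {a′} eq = proj-≡⁺ (classes S) λ {j} j∈ → let (x , x∈S , cx) = ∈-classes⁻ j∈ in
      trans (cong (value a) (sym cx)) (trans (sym (lookup-φ a x)) (trans (proj-≡⁻ eq x∈S)
        (trans (lookup-φ a′ x) (cong (value a′) cx))))

    proj-classes-≡⇒proj-φ-≡ : ∀ S {a a′} → proj (classes S) a ≡ proj (classes S) a′ → proj S (φ a) ≡ proj S (φ a′)
    proj-classes-≡⇒proj-φ-≡ S {a} {a′} eq = proj-≡⁺ S λ {x} x∈S →
      trans (lookup-φ a x) (trans (same-value x∈S (classOf x) refl) (sym (lookup-φ a′ x)))
      where
      same-value : ∀ {x} → x ∈ S → ∀ c → classOf x ≡ c → value a c ≡ value a′ c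
      same-value _   nothing  _  = refl
      same-value x∈S (just j) cx = proj-≡⁻ eq (∈-classes⁺ x∈S cx)

    projCard-image-φ : ∀ S → projCard image-φ S ≡ m ^ ∣ classes S ∣
    projCard-image-φ S = begin
      card _≟ᵖ_ (map (proj S) (map φ (allVectors m size)))    ≡⟨ cong (card _≟ᵖ_) (map-∘ (allVectors m size)) ⟨
      card _≟ᵖ_ (map (proj S ∘ φ) (allVectors m size))        ≡⟨ card-map-sameKernel _≟ᵖ_ _≟ᵖ_
                                                                   (proj S ∘ φ) (proj (classes S)) εᵛ (allVectors m size)
                                                                   (λ _ _ → proj-φ-≡⇒proj-classes-≡ S)
                                                                   (λ _ _ → proj-classes-≡⇒proj-φ-≡ S) ⟩
      card _≟ᵖ_ (map (proj (classes S)) (allVectors m size))  ≡⟨ card-proj-allVectors (classes S) ε ⟩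
      m ^ ∣ classes S ∣                                       ∎
      where open ≡-Reasoning

    freeSimplification⇒representable : Representable Γ r
    freeSimplification⇒representable = n , image-φ , ↔-id (Fin n) , λ S →
      trans (cong (projCard image-φ) (image-id S)) (trans (projCard-image-φ S) (cong (m ^_) (sym (rank-classes S))))

theorem5p1 : ∀ {m} (Γ : FinGroup m) → NonAbelian Γ →
  ∀ {n} (r : Rank n) → IsMatroid r →
    (Representable Γ r ⇔ (¬ HasMinor r (U 2 3)))
    × ((¬ HasMinor r (U 2 3)) ⇔ (SimplificationIsFree r ⊎ AllLoops r))
    × ((SimplificationIsFree r ⊎ AllLoops r) ⇔
       (∀ {m′} → 2 ≤ m′ → (Γ′ : FinGroup m′) → Representable Γ′ r))
theorem5p1 Γ nonAbelian r mat =
  mk⇔ ¬minor (representable ∘ free-or-loops) ,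
  mk⇔ free-or-loops (¬minor ∘ representable) ,
  mk⇔ (λ free {_} _ Γ′ → representable-over free Γ′)
      (λ everywhere → free-or-loops (¬minor (everywhere 2≤order Γ)))
  where
  2≤order : 2 ≤ _
  2≤order = nonAbelian⇒2≤order Γ nonAbelian
  ¬minor : Representable Γ r → ¬ HasMinor r (U 2 3)
  ¬minor = representable⇒¬U₂,₃-minor Γ nonAbelian
  free-or-loops : ¬ HasMinor r (U 2 3) → SimplificationIsFree r ⊎ AllLoops r
  free-or-loops = inj₁ ∘ freeSimplification⇒simplificationIsFree ∘ trivialClosure⇒freeSimplification mat
                  ∘ ¬U₂,₃-minor⇒trivialClosure mat
  -- (4) holds for every finite group, without the size bound.
  representable-over : SimplificationIsFree r ⊎ AllLoops r → ∀ {m′} (Γ′ : FinGroup m′) → Representable Γ′ r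
  representable-over = freeSimplification⇒representable mat
                       ∘ [ simplificationIsFree⇒freeSimplification , allLoops⇒freeSimplification mat ]
  representable : SimplificationIsFree r ⊎ AllLoops r → Representable Γ r
  representable free = representable-over free Γ
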